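{- Any online MA communication protocol $\mathcal P$ for the $(m,n)$-Sparse INDEX problem with error at most $1/3$ and $\mathrm{hcost}(\mathcal P)\ge\log n$ must satisfy $\mathrm{hcost}(\mathcal P)\cdot\mathrm{vcost}(\mathcal P)=\Omega(m\log(n/m))$.
   Context: $(m,n)$-Sparse INDEX: Alice holds $x\in\{0,1\}^n$ of Hamming weight at most $m$, Bob holds an index $\iota\in[n]$; the output is $x_\iota$. Online MA communication for $F:X\times Y\to\{0,1\}$: (1) Alice and Merlin see $x$; (2) Merlin, using a private random string $r_M$, sends Alice a help message $\mathfrak h_1(x,r_M)$; (3) Bob receives $y$; (4) Merlin sends Bob $\mathfrak h_2(x,y,r_M)$; (5) Alice sends Bob a message that may use a public random string $r_A$ (not known to Merlin when he sends his messages), and Bob outputs a bit. The protocol is $\delta_c$-complete and $\delta_s$-sound if there exist help functions such that: if $F(x,y)=1$ then $\Pr_{r_M,r_A}[\text{output}=0]\le\delta_c$; if $F(x,y)=0$ then for all help messages $\Pr_{r_A}[\text{output}=1]\le\delta_s$. The error is the least $\max\{\delta_s,\delta_c\}$. $\mathrm{hcost}(\mathcal P)=1+\max_{x,y,r_M}(|\mathfrak h_1|+|\mathfrak h_2|)$ and $\mathrm{vcost}(\mathcal P)$ is the maximum number of bits communicated between Alice and Bob. -}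

module Defs where

open import Data.Nat using (ℕ; zero; suc; _+_; _*_; _^_; _≤_)
open import Data.Bool using (Bool; true; false; if_then_else_)
open import Data.Fin using (Fin)
open import Data.Vec using (Vec; []; _∷_; lookup)
open import Data.List using (List; length)
open import Data.Product using (Σ; _×_; ∃-syntax; proj₁)
open import Relation.Binary.PropositionalEquality using (_≡_)

sumStrings : (ℓ : ℕ) → (Vec Bool ℓ → ℕ) → ℕ
sumStrings zero    g = g []
sumStrings (suc ℓ) g = sumStrings ℓ (λ r → g (true ∷ r)) + sumStrings ℓ (λ r → g (false ∷ r))

ind : Bool → ℕ
ind b = if b then 1 else 0

countStrings : (ℓ : ℕ) → (Vec Bool ℓ → Bool) → ℕ
countStrings ℓ p = sumStrings ℓ (λ r → ind (p r))

notB : Bool → Bool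
notB true  = false
notB false = true

-- Merlin's private random string r_M ∈ {0,1}^ℓM, Alice's public random string r_A ∈ {0,1}^ℓA
-- (both uniform).  The honest help functions h₁, h₂ are part of the protocol.
record Protocol (X Y : Set) : Set where
  field
    ℓM ℓA : ℕ
    h₁    : X → Vec Bool ℓM → List Bool                         -- Merlin → Alice
    h₂    : X → Y → Vec Bool ℓM → List Bool                     -- Merlin → Bob
    alice : X → List Bool → Vec Bool ℓA → List Bool             -- Alice → Bob (given x, help h₁, r_A)
    bob   : Y → List Bool → List Bool → Vec Bool ℓA → Bool      -- Bob's output (y, help h₂, Alice's msg, r_A)

open Protocol public

run : {X Y : Set} → (P : Protocol X Y) → X → Y → List Bool → List Bool → Vec Bool (ℓA P) → Bool
run P x y m₁ m₂ rA = bob P y m₂ (alice P x m₁ rA) rA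

-- δ_c ≤ 1/3 : with honest help, Pr_{r_M,r_A}[output = 0] ≤ 1/3 whenever F(x,y) = 1.
Complete⅓ : {X Y : Set} → (X → Y → Bool) → Protocol X Y → Set
Complete⅓ {X} {Y} F P = ∀ (x : X) (y : Y) → F x y ≡ true →
  3 * sumStrings (ℓM P) (λ rM →
        countStrings (ℓA P) (λ rA → notB (run P x y (h₁ P x rM) (h₂ P x y rM) rA)))
    ≤ 2 ^ (ℓM P + ℓA P)

-- δ_s ≤ 1/3 : for all help messages, Pr_{r_A}[output = 1] ≤ 1/3 whenever F(x,y) = 0.
Sound⅓ : {X Y : Set} → (X → Y → Bool) → Protocol X Y → Set
Sound⅓ {X} {Y} F P = ∀ (x : X) (y : Y) → F x y ≡ false → ∀ (m₁ m₂ : List Bool) →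
  3 * countStrings (ℓA P) (λ rA → run P x y m₁ m₂ rA) ≤ 2 ^ ℓA P

-- Error at most 1/3 (the least max{δ_s, δ_c} is ≤ 1/3 iff both can be taken ≤ 1/3).
ErrorAtMost⅓ : {X Y : Set} → (X → Y → Bool) → Protocol X Y → Set
ErrorAtMost⅓ F P = Complete⅓ F P × Sound⅓ F P

IsHCost : {X Y : Set} → Protocol X Y → ℕ → Set
IsHCost {X} {Y} P h =
  (∀ (x : X) (y : Y) rM → 1 + (length (h₁ P x rM) + length (h₂ P x y rM)) ≤ h) ×
  (∃[ x ] ∃[ y ] ∃[ rM ] 1 + (length (h₁ P x rM) + length (h₂ P x y rM)) ≡ h)

IsVCost : {X Y : Set} → Protocol X Y → ℕ → Set
IsVCost {X} {Y} P v =
  (∀ (x : X) m₁ rA → length (alice P x m₁ rA) ≤ v) ×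
  (∃[ x ] ∃[ m₁ ] ∃[ rA ] length (alice P x m₁ rA) ≡ v)

weight : {n : ℕ} → Vec Bool n → ℕ
weight []       = 0
weight (b ∷ xs) = ind b + weight xs

SparseInput : ℕ → ℕ → Set
SparseInput m n = Σ (Vec Bool n) (λ x → weight x ≤ m)

sparseIndex : (m n : ℕ) → SparseInput m n → Fin n → Bool
sparseIndex m n x ι = lookup (proj₁ x) ι

-- A code c ∈ [b]^t with t ≤ m, t b ≤ n places one 1 in each of t blocks of size b.  Fix for
-- each c Merlin's coins, and run the protocol k = 2j times with independent public coins; Bob
-- decodes cell (i, o) of block i if some help message of length ≤ h makes him accept at least
-- j of the runs.  By Markov, true cells are rarely missed; by Chernoff plus a union bound over
-- the 2^(2h+6) cells and help messages, false cells are almost never decoded.  Fixing the public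
-- coins, 9/60 of the codes are recovered without error in more than t/6 blocks from Alice's k
-- messages alone, which take at most 2^((v+1)k) values.  Hence b^(t/6) ≲ 2^((v+1)k), so
-- b^t ≤ 2^(O(hv)), and t = m, b = n/m gives (n/m)^m ≤ 2^(O(hv)).

module Submission where

open import Defs
open import Data.Nat using (ℕ; _*_; _^_; _≤_)
open import Data.Nat.Logarithm using (⌈log₂_⌉)
open import Data.Fin using (Fin)
open import Data.Product using (∃-syntax)

open import Data.Nat hiding (_≟_)
open import Data.Nat.Properties hiding (_≟_)
open import Data.Nat.DivMod using (_/_; _%_; m/n*n≤m; m≡m%n+[m/n]*n; m%n<n; /-monoˡ-≤; m*n/n≡m)
open import Data.Nat.Induction using (<-rec)
open import Data.Nat.Logarithm using (⌈log₂⌉-mono-≤; ⌈log₂2^n⌉≡n; ⌈log₂⌈n/2⌉⌉≡⌈log₂n⌉∸1)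
open import Data.Nat.Tactic.RingSolver using (solve-∀)
open import Algebra.Properties.CommutativeSemigroup +-commutativeSemigroup
  using () renaming (interchange to +-interchange)
open import Data.Bool using (Bool; true; false; _∧_)
open import Data.Bool.Properties using (∧-zeroʳ; ∧-identityʳ; T-≡)
open import Data.Fin using (zero; suc; combine; inject≤; fromℕ<; _≟_)
open import Data.Fin.Properties using (combine-injectiveˡ; combine-injectiveʳ; inject≤-injective)
open import Data.List using (List; []; _∷_; _++_; map; length; concatMap; tabulate; allFin)
open import Data.List.Properties using (length-map; length-++; length-tabulate)
open import Data.List.Relation.Unary.Any using (here; there)
import Data.List.Relation.Unary.Any as Any
open import Data.List.Membership.Propositional using (_∈_)
open import Data.List.Membership.Propositional.Properties
  using (∈-map⁺; ∈-++⁺ˡ; ∈-++⁺ʳ; ∈-concatMap⁺; ∈-allFin)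
open import Data.Vec using (Vec; []; _∷_; lookup)
import Data.Vec as Vec
open import Data.Vec.Properties using (lookup∘tabulate; lookup-map; lookup-replicate)
open import Data.Product using (_,_; proj₁; proj₂; _×_)
open import Data.Empty using (⊥; ⊥-elim)
open import Function using (_∘_; case_of_; Equivalence)
open import Relation.Nullary using (Dec; yes; no; does)
open import Relation.Nullary.Decidable using (dec-true; dec-false)
open import Relation.Binary.PropositionalEquality

private
  variable
    A B : Set

∑ : List A → (A → ℕ) → ℕ
∑ []       f = 0
∑ (a ∷ as) f = f a + ∑ as f

∑-mono-≤ : (xs : List A) {f g : A → ℕ} → (∀ a → f a ≤ g a) → ∑ xs f ≤ ∑ xs g
∑-mono-≤ []       f≤g = z≤n
∑-mono-≤ (a ∷ xs) f≤g = +-mono-≤ (f≤g a) (∑-mono-≤ xs f≤g)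

∑-cong : (xs : List A) {f g : A → ℕ} → (∀ a → f a ≡ g a) → ∑ xs f ≡ ∑ xs g
∑-cong []       f≡g = refl
∑-cong (a ∷ xs) f≡g = cong₂ _+_ (f≡g a) (∑-cong xs f≡g)

∑-distrib-+ : (xs : List A) (f g : A → ℕ) → ∑ xs (λ a → f a + g a) ≡ ∑ xs f + ∑ xs g
∑-distrib-+ []       f g = refl
∑-distrib-+ (a ∷ xs) f g =
  trans (cong (f a + g a +_) (∑-distrib-+ xs f g)) (+-interchange (f a) (g a) (∑ xs f) (∑ xs g))

∑-distribˡ-* : (xs : List A) (c : ℕ) (f : A → ℕ) → ∑ xs (λ a → c * f a) ≡ c * ∑ xs f
∑-distribˡ-* []       c f = sym (*-zeroʳ c)
∑-distribˡ-* (a ∷ xs) c f =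
  trans (cong (c * f a +_) (∑-distribˡ-* xs c f)) (sym (*-distribˡ-+ c (f a) (∑ xs f)))

∑-const : (xs : List A) (c : ℕ) → ∑ xs (λ _ → c) ≡ length xs * c
∑-const []       c = refl
∑-const (a ∷ xs) c = cong (c +_) (∑-const xs c)

∑-zero : (xs : List A) {f : A → ℕ} → (∀ a → f a ≡ 0) → ∑ xs f ≡ 0
∑-zero []       f≡0 = refl
∑-zero (a ∷ xs) f≡0 = cong₂ _+_ (f≡0 a) (∑-zero xs f≡0)

∑-≤-length* : (xs : List A) {f : A → ℕ} (c : ℕ) → (∀ a → f a ≤ c) → ∑ xs f ≤ length xs * c
∑-≤-length* xs c f≤c = ≤-trans (∑-mono-≤ xs f≤c) (≤-reflexive (∑-const xs c))

∑-++ : (xs ys : List A) (f : A → ℕ) → ∑ (xs ++ ys) f ≡ ∑ xs f + ∑ ys f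
∑-++ []       ys f = refl
∑-++ (a ∷ xs) ys f = trans (cong (f a +_) (∑-++ xs ys f)) (sym (+-assoc (f a) (∑ xs f) (∑ ys f)))

∑-map : (g : A → B) (xs : List A) (f : B → ℕ) → ∑ (map g xs) f ≡ ∑ xs (f ∘ g)
∑-map g []       f = refl
∑-map g (a ∷ xs) f = cong (f (g a) +_) (∑-map g xs f)

∑-concatMap : (g : A → List B) (xs : List A) (f : B → ℕ) →
              ∑ (concatMap g xs) f ≡ ∑ xs (λ a → ∑ (g a) f)
∑-concatMap g []       f = refl
∑-concatMap g (a ∷ xs) f = trans (∑-++ (g a) (concatMap g xs) f) (cong (∑ (g a) f +_) (∑-concatMap g xs f))

∑-comm : (xs : List A) (ys : List B) (f : A → B → ℕ) →
         ∑ xs (λ a → ∑ ys (f a)) ≡ ∑ ys (λ b → ∑ xs (λ a → f a b))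
∑-comm []       ys f = sym (∑-zero ys (λ _ → refl))
∑-comm (a ∷ xs) ys f =
  trans (cong (∑ ys (f a) +_) (∑-comm xs ys f)) (sym (∑-distrib-+ ys (f a) (λ b → ∑ xs (λ a′ → f a′ b))))

∈⇒≤∑ : {xs : List A} {a : A} (f : A → ℕ) → a ∈ xs → f a ≤ ∑ xs f
∈⇒≤∑ {xs = x ∷ xs} f (here refl) = m≤m+n (f x) (∑ xs f)
∈⇒≤∑ {xs = x ∷ xs} f (there a∈xs) = ≤-trans (∈⇒≤∑ f a∈xs) (m≤n+m (∑ xs f) (f x))

∑-positive⇒∃ : (xs : List A) (f : A → ℕ) → 1 ≤ ∑ xs f → ∃[ a ] 1 ≤ f a
∑-positive⇒∃ (a ∷ xs) f 1≤∑ with f a in fa≡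
... | zero  = ∑-positive⇒∃ xs f 1≤∑
... | suc _ = a , ≤-trans (s≤s z≤n) (≤-reflexive (sym fa≡))

∑-average : (xs : List A) (f : A → ℕ) (K : ℕ) → 1 ≤ length xs →
            ∑ xs f ≤ length xs * K → ∃[ a ] f a ≤ K
∑-average (a ∷ xs) f K _ ∑≤ with f a ≤? K
... | yes fa≤K = a , fa≤K
∑-average (a ∷ []) f K _ ∑≤ | no fa≰K =
  ⊥-elim (fa≰K (≤-trans (m≤m+n (f a) 0) (≤-trans ∑≤ (≤-reflexive (+-identityʳ K)))))
∑-average (a ∷ xs@(_ ∷ _)) f K _ ∑≤ | no fa≰K =
  ∑-average xs f K (s≤s z≤n) (+-cancelˡ-≤ K _ _ (≤-trans (+-monoˡ-≤ (∑ xs f) (<⇒≤ (≰⇒> fa≰K))) ∑≤))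

∑-tabulate : ∀ {n} (g : Fin n → A) (f : A → ℕ) → ∑ (tabulate g) f ≡ ∑ (allFin n) (f ∘ g)
∑-tabulate {n = zero}  g f = refl
∑-tabulate {n = suc n} g f =
  cong (f (g zero) +_) (trans (∑-tabulate (g ∘ suc) f) (sym (∑-tabulate suc (f ∘ g))))

∑-allFin-suc : ∀ n (f : Fin (suc n) → ℕ) → ∑ (allFin (suc n)) f ≡ f zero + ∑ (allFin n) (f ∘ suc)
∑-allFin-suc n f = cong (f zero +_) (∑-tabulate suc f)

length-allFin : ∀ n → length (allFin n) ≡ n
length-allFin n = length-tabulate (λ i → i)

bitStrings : (ℓ : ℕ) → List (Vec Bool ℓ)
bitStrings zero    = [] ∷ []
bitStrings (suc ℓ) = map (true ∷_) (bitStrings ℓ) ++ map (false ∷_) (bitStrings ℓ)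

sumStrings≡∑ : ∀ ℓ (g : Vec Bool ℓ → ℕ) → sumStrings ℓ g ≡ ∑ (bitStrings ℓ) g
sumStrings≡∑ zero    g = sym (+-identityʳ (g []))
sumStrings≡∑ (suc ℓ) g = begin
  sumStrings ℓ (g ∘ (true ∷_)) + sumStrings ℓ (g ∘ (false ∷_))
    ≡⟨ cong₂ _+_ (sumStrings≡∑ ℓ (g ∘ (true ∷_))) (sumStrings≡∑ ℓ (g ∘ (false ∷_))) ⟩
  ∑ (bitStrings ℓ) (g ∘ (true ∷_)) + ∑ (bitStrings ℓ) (g ∘ (false ∷_))
    ≡⟨ sym (cong₂ _+_ (∑-map (true ∷_) (bitStrings ℓ) g) (∑-map (false ∷_) (bitStrings ℓ) g)) ⟩
  ∑ (map (true ∷_) (bitStrings ℓ)) g + ∑ (map (false ∷_) (bitStrings ℓ)) g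
    ≡⟨ sym (∑-++ (map (true ∷_) (bitStrings ℓ)) _ g) ⟩
  ∑ (bitStrings (suc ℓ)) g ∎
  where open ≡-Reasoning

length-bitStrings : ∀ ℓ → length (bitStrings ℓ) ≡ 2 ^ ℓ
length-bitStrings zero    = refl
length-bitStrings (suc ℓ) =
  trans (length-++ (map (true ∷_) Bs))
        (cong₂ _+_ (trans (length-map (true ∷_) Bs) (length-bitStrings ℓ))
                   (trans (length-map (false ∷_) Bs) (trans (length-bitStrings ℓ) (sym (+-identityʳ _)))))
  where Bs = bitStrings ℓ

lists≤ : ℕ → List (List Bool)
lists≤ zero    = [] ∷ []
lists≤ (suc v) = [] ∷ (map (true ∷_) (lists≤ v) ++ map (false ∷_) (lists≤ v))

length-lists≤ : ∀ v → suc (length (lists≤ v)) ≡ 2 ^ suc v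
length-lists≤ zero    = refl
length-lists≤ (suc v) = begin
  suc (suc (length (map (true ∷_) L ++ map (false ∷_) L)))
    ≡⟨ cong (2 +_) (trans (length-++ (map (true ∷_) L))
                           (cong₂ _+_ (length-map (true ∷_) L) (length-map (false ∷_) L))) ⟩
  suc (suc (length L + length L))  ≡⟨ cong suc (sym (+-suc (length L) (length L))) ⟩
  suc (length L) + suc (length L)  ≡⟨ cong₂ _+_ (length-lists≤ v) (length-lists≤ v) ⟩
  2 ^ suc v + 2 ^ suc v            ≡⟨ cong (2 ^ suc v +_) (sym (+-identityʳ _)) ⟩
  2 ^ suc (suc v)                  ∎
  where
  open ≡-Reasoning
  L = lists≤ v

∈-lists≤ : ∀ v (l : List Bool) → length l ≤ v → l ∈ lists≤ v
∈-lists≤ zero    []          _       = here refl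
∈-lists≤ (suc v) []          _       = here refl
∈-lists≤ (suc v) (true ∷ l)  (s≤s p) = there (∈-++⁺ˡ (∈-map⁺ (true ∷_) (∈-lists≤ v l p)))
∈-lists≤ (suc v) (false ∷ l) (s≤s p) = there (∈-++⁺ʳ _ (∈-map⁺ (false ∷_) (∈-lists≤ v l p)))

allVecs : List A → (k : ℕ) → List (Vec A k)
allVecs xs zero    = [] ∷ []
allVecs xs (suc k) = concatMap (λ a → map (a ∷_) (allVecs xs k)) xs

∑-allVecs-suc : (xs : List A) (k : ℕ) (f : Vec A (suc k) → ℕ) →
                ∑ (allVecs xs (suc k)) f ≡ ∑ xs (λ a → ∑ (allVecs xs k) (f ∘ (a ∷_)))
∑-allVecs-suc xs k f =
  trans (∑-concatMap (λ a → map (a ∷_) (allVecs xs k)) xs f) (∑-cong xs (λ a → ∑-map (a ∷_) (allVecs xs k) f))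

length-allVecs : (xs : List A) (k : ℕ) → length (allVecs xs k) ≡ length xs ^ k
length-allVecs xs k = trans (sym (trans (∑-const (allVecs xs k) 1) (*-identityʳ _))) (count k)
  where
  count : ∀ k → ∑ (allVecs xs k) (λ _ → 1) ≡ length xs ^ k
  count zero    = refl
  count (suc k) = trans (∑-allVecs-suc xs k (λ _ → 1))
                        (trans (∑-cong xs (λ _ → count k)) (∑-const xs (length xs ^ k)))

∈-allVecs : (xs : List A) {k : ℕ} (R : Vec A k) → (∀ i → lookup R i ∈ xs) → R ∈ allVecs xs k
∈-allVecs xs []      _    = here refl
∈-allVecs xs (a ∷ R) R⊆xs =
  ∈-concatMap⁺ (λ a′ → map (a′ ∷_) (allVecs xs _)) (Any.map (λ { refl → ∈-map⁺ (a ∷_) (∈-allVecs xs R (R⊆xs ∘ suc)) }) (R⊆xs zero))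

^-distribʳ-* : ∀ m n o → (m * n) ^ o ≡ m ^ o * n ^ o
^-distribʳ-* m n zero    = refl
^-distribʳ-* m n (suc o) = trans (cong (m * n *_) (^-distribʳ-* m n o)) (exchange m n (m ^ o) (n ^ o))
  where
  exchange : ∀ a b c d → a * b * (c * d) ≡ a * c * (b * d)
  exchange = solve-∀

≤ᵇ≡true⇒≤ : ∀ m n → (m ≤ᵇ n) ≡ true → m ≤ n
≤ᵇ≡true⇒≤ m n eq = ≤ᵇ⇒≤ m n (Equivalence.from T-≡ eq)

≤⇒≤ᵇ≡true : ∀ {m n} → m ≤ n → (m ≤ᵇ n) ≡ true
≤⇒≤ᵇ≡true m≤n = Equivalence.to T-≡ (≤⇒≤ᵇ m≤n)

≤ᵇ≡false⇒> : ∀ m n → (m ≤ᵇ n) ≡ false → n < m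
≤ᵇ≡false⇒> m n eq = ≰⇒> (λ m≤n → case trans (sym eq) (≤⇒≤ᵇ≡true m≤n) of λ ())

*-ind-≤ᵇ-≤ : (f : ℕ → ℕ) → (∀ {a b} → a ≤ b → f a ≤ f b) → ∀ j s → f j * ind (j ≤ᵇ s) ≤ f s
*-ind-≤ᵇ-≤ f f-mono j s with j ≤ᵇ s in eq
... | true  = ≤-trans (≤-reflexive (*-identityʳ (f j))) (f-mono (≤ᵇ≡true⇒≤ j s eq))
... | false = ≤-trans (≤-reflexive (*-zeroʳ (f j))) z≤n

ind≤1 : ∀ b → ind b ≤ 1
ind≤1 true  = ≤-refl
ind≤1 false = z≤n

ind-notB≤ : ∀ {b x} → (b ≡ false → 1 ≤ x) → ind (notB b) ≤ x
ind-notB≤ {true}  _     = z≤n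
ind-notB≤ {false} 1≤x = 1≤x refl

ind≤ind : ∀ {x y} → (x ≡ true → y ≡ true) → ind x ≤ ind y
ind≤ind {false} _   = z≤n
ind≤ind {true}  t⇒t = ≤-reflexive (cong ind (sym (t⇒t refl)))

ind*≤ : ∀ {x a d} → (x ≡ true → a ≤ d) → ind x * a ≤ d
ind*≤ {false} _   = z≤n
ind*≤ {true}  a≤d = ≤-trans (≤-reflexive (+-identityʳ _)) (a≤d refl)

1≤ind⇒≡true : ∀ {x} → 1 ≤ ind x → x ≡ true
1≤ind⇒≡true {true} _ = refl

ind+ind-notB : ∀ b → ind b + ind (notB b) ≡ 1
ind+ind-notB true  = refl
ind+ind-notB false = refl

∏ : (k : ℕ) → (Fin k → ℕ) → ℕ
∏ zero    g = 1
∏ (suc k) g = g zero * ∏ k (g ∘ suc)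

∏-const : ∀ k c → ∏ k (λ _ → c) ≡ c ^ k
∏-const zero    c = refl
∏-const (suc k) c = cong (c *_) (∏-const k c)

∏ᵛ : ∀ {k} → (Fin k → A → ℕ) → Vec A k → ℕ
∏ᵛ g []      = 1
∏ᵛ g (a ∷ R) = g zero a * ∏ᵛ (g ∘ suc) R

∏ᵛ-one : ∀ {k} (g : Fin k → A → ℕ) (R : Vec A k) → (∀ i → g i (lookup R i) ≡ 1) → ∏ᵛ g R ≡ 1
∏ᵛ-one g []      g≡1 = refl
∏ᵛ-one g (a ∷ R) g≡1 = cong₂ _*_ (g≡1 zero) (∏ᵛ-one (g ∘ suc) R (g≡1 ∘ suc))

∑-allVecs-∏ᵛ : (xs : List A) (k : ℕ) (g : Fin k → A → ℕ) →
               ∑ (allVecs xs k) (∏ᵛ g) ≡ ∏ k (λ i → ∑ xs (g i))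
∑-allVecs-∏ᵛ xs zero    g = refl
∑-allVecs-∏ᵛ xs (suc k) g = begin
  ∑ (allVecs xs (suc k)) (∏ᵛ g)
    ≡⟨ ∑-allVecs-suc xs k (∏ᵛ g) ⟩
  ∑ xs (λ a → ∑ (allVecs xs k) (λ R → g zero a * ∏ᵛ (g ∘ suc) R))
    ≡⟨ ∑-cong xs (λ a → ∑-distribˡ-* (allVecs xs k) (g zero a) (∏ᵛ (g ∘ suc))) ⟩
  ∑ xs (λ a → g zero a * ∑ (allVecs xs k) (∏ᵛ (g ∘ suc)))
    ≡⟨ ∑-cong xs (λ a → cong (g zero a *_) (∑-allVecs-∏ᵛ xs k (g ∘ suc))) ⟩
  ∑ xs (λ a → g zero a * rest)
    ≡⟨ ∑-cong xs (λ a → *-comm (g zero a) rest) ⟩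
  ∑ xs (λ a → rest * g zero a)
    ≡⟨ ∑-distribˡ-* xs rest (g zero) ⟩
  rest * ∑ xs (g zero)
    ≡⟨ *-comm rest _ ⟩
  ∏ (suc k) (λ i → ∑ xs (g i)) ∎
  where
  open ≡-Reasoning
  rest = ∏ k (λ i → ∑ xs (g (suc i)))

hits : ∀ {k} → (A → Bool) → Vec A k → ℕ
hits p []      = 0
hits p (a ∷ R) = ind (p a) + hits p R

hits+hits-notB : ∀ {k} (p : A → Bool) (R : Vec A k) → hits p R + hits (notB ∘ p) R ≡ k
hits+hits-notB p []      = refl
hits+hits-notB p (a ∷ R) =
  trans (+-interchange (ind (p a)) (hits p R) (ind (notB (p a))) (hits (notB ∘ p) R))
        (cong₂ _+_ (ind+ind-notB (p a)) (hits+hits-notB p R))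

2^hits : ∀ {k} (p : A → Bool) (R : Vec A k) → 2 ^ hits p R ≡ ∏ᵛ (λ _ a → 1 + ind (p a)) R
2^hits p []      = refl
2^hits p (a ∷ R) = trans (^-distribˡ-+-* 2 (ind (p a)) (hits p R)) (cong₂ _*_ (2^ind (p a)) (2^hits p R))
  where
  2^ind : ∀ b → 2 ^ ind b ≡ 1 + ind b
  2^ind true  = refl
  2^ind false = refl

∑-hits : (xs : List A) (k : ℕ) (p : A → Bool) →
         ∑ (allVecs xs k) (hits p) * length xs ≡ k * ∑ xs (ind ∘ p) * length xs ^ k
∑-hits xs zero    p = refl
∑-hits xs (suc k) p = begin
  ∑ (allVecs xs (suc k)) (hits p) * N
    ≡⟨ cong (_* N) (∑-allVecs-suc xs k (hits p)) ⟩
  ∑ xs (λ a → ∑ (allVecs xs k) (λ R → ind (p a) + hits p R)) * N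
    ≡⟨ cong (_* N) (∑-cong xs (λ a → ∑-distrib-+ (allVecs xs k) (λ _ → ind (p a)) (hits p))) ⟩
  ∑ xs (λ a → ∑ (allVecs xs k) (λ _ → ind (p a)) + H) * N
    ≡⟨ cong (_* N) (∑-distrib-+ xs _ (λ _ → H)) ⟩
  (∑ xs (λ a → ∑ (allVecs xs k) (λ _ → ind (p a))) + ∑ xs (λ _ → H)) * N
    ≡⟨ cong (λ z → (z + ∑ xs (λ _ → H)) * N) (∑-cong xs (λ a → ∑-const (allVecs xs k) (ind (p a)))) ⟩
  (∑ xs (λ a → length (allVecs xs k) * ind (p a)) + ∑ xs (λ _ → H)) * N
    ≡⟨ cong₂ (λ u w → (u + w) * N) (trans (∑-distribˡ-* xs (length (allVecs xs k)) (ind ∘ p)) (cong (_* G) (length-allVecs xs k)))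
                                    (∑-const xs H) ⟩
  (N ^ k * G + N * H) * N
    ≡⟨ cong (λ z → (N ^ k * G + z) * N) (*-comm N H) ⟩
  (N ^ k * G + H * N) * N
    ≡⟨ cong (λ z → (N ^ k * G + z) * N) (∑-hits xs k p) ⟩
  (N ^ k * G + k * G * N ^ k) * N
    ≡⟨ collect (N ^ k) G N k ⟩
  suc k * G * N ^ suc k ∎
  where
  open ≡-Reasoning
  N = length xs
  G = ∑ xs (ind ∘ p)
  H = ∑ (allVecs xs k) (hits p)
  collect : ∀ q g n k → (q * g + k * g * q) * n ≡ (1 + k) * g * (n * q)
  collect = solve-∀

markov : (xs : List A) (p : A → Bool) (j : ℕ) →
         length xs * ∑ (allVecs xs (j + j)) (λ R → ind (suc j ≤ᵇ hits p R))
           ≤ 2 * ∑ xs (ind ∘ p) * length xs ^ (j + j)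
markov xs p j = *-cancelˡ-≤ (suc j) (begin
  suc j * (N * tail)
    ≡⟨ swap (suc j) N tail ⟩
  N * (suc j * tail)
    ≡⟨ cong (N *_) (sym (∑-distribˡ-* (allVecs xs k) (suc j) _)) ⟩
  N * ∑ (allVecs xs k) (λ R → suc j * ind (suc j ≤ᵇ hits p R))
    ≤⟨ *-monoʳ-≤ N (∑-mono-≤ (allVecs xs k) (λ R → *-ind-≤ᵇ-≤ (λ z → z) (λ a≤b → a≤b) (suc j) (hits p R))) ⟩
  N * ∑ (allVecs xs k) (hits p)
    ≡⟨ trans (*-comm N _) (∑-hits xs k p) ⟩
  k * G * N ^ k
    ≤⟨ *-monoˡ-≤ (N ^ k) (*-monoˡ-≤ G (+-mono-≤ (n≤1+n j) (n≤1+n j))) ⟩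
  (suc j + suc j) * G * N ^ k
    ≡⟨ double (suc j) G (N ^ k) ⟩
  suc j * (2 * G * N ^ k) ∎)
  where
  open ≤-Reasoning
  k = j + j
  N = length xs
  G = ∑ xs (ind ∘ p)
  tail = ∑ (allVecs xs k) (λ R → ind (suc j ≤ᵇ hits p R))
  swap : ∀ a b c → a * (b * c) ≡ b * (a * c)
  swap = solve-∀
  double : ∀ a g q → (a + a) * g * q ≡ a * (2 * g * q)
  double = solve-∀

chernoff : (xs : List A) (p : A → Bool) (j : ℕ) → 3 * ∑ xs (ind ∘ p) ≤ length xs →
           9 ^ j * ∑ (allVecs xs (j + j)) (λ R → ind (j ≤ᵇ hits p R)) ≤ 8 ^ j * length xs ^ (j + j)
chernoff xs p j 3∑≤N = *-cancelˡ-≤ (2 ^ j) {{m^n≢0 2 j}} (begin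
  2 ^ j * (9 ^ j * tail)
    ≡⟨ cong (λ z → 2 ^ j * (z * tail)) 9^j≡3^k ⟩
  2 ^ j * (3 ^ k * tail)
    ≡⟨ swap (2 ^ j) (3 ^ k) tail ⟩
  3 ^ k * (2 ^ j * tail)
    ≡⟨ cong (3 ^ k *_) (sym (∑-distribˡ-* (allVecs xs k) (2 ^ j) _)) ⟩
  3 ^ k * ∑ (allVecs xs k) (λ R → 2 ^ j * ind (j ≤ᵇ hits p R))
    ≤⟨ *-monoʳ-≤ (3 ^ k) (∑-mono-≤ (allVecs xs k) (λ R → *-ind-≤ᵇ-≤ (2 ^_) (^-monoʳ-≤ 2) j (hits p R))) ⟩
  3 ^ k * ∑ (allVecs xs k) (λ R → 2 ^ hits p R)
    ≡⟨ cong (3 ^ k *_) (trans (∑-cong (allVecs xs k) (2^hits p)) (∑-allVecs-∏ᵛ xs k _)) ⟩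
  3 ^ k * ∏ k (λ _ → ∑ xs (λ a → 1 + ind (p a)))
    ≡⟨ cong (3 ^ k *_) (∏-const k _) ⟩
  3 ^ k * ∑ xs (λ a → 1 + ind (p a)) ^ k
    ≡⟨ sym (^-distribʳ-* 3 _ k) ⟩
  (3 * ∑ xs (λ a → 1 + ind (p a))) ^ k
    ≤⟨ ^-monoˡ-≤ k 3∑≤4N ⟩
  (4 * N) ^ k
    ≡⟨ ^-distribʳ-* 4 N k ⟩
  4 ^ k * N ^ k
    ≡⟨ cong (_* N ^ k) 4^k≡2^j*8^j ⟩
  2 ^ j * 8 ^ j * N ^ k
    ≡⟨ *-assoc (2 ^ j) (8 ^ j) (N ^ k) ⟩
  2 ^ j * (8 ^ j * N ^ k) ∎)
  where
  open ≤-Reasoning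
  k = j + j
  N = length xs
  tail = ∑ (allVecs xs k) (λ R → ind (j ≤ᵇ hits p R))
  swap : ∀ a b c → a * (b * c) ≡ b * (a * c)
  swap = solve-∀
  9^j≡3^k : 9 ^ j ≡ 3 ^ k
  9^j≡3^k = trans (^-distribʳ-* 3 3 j) (sym (^-distribˡ-+-* 3 j j))
  4^k≡2^j*8^j : 4 ^ k ≡ 2 ^ j * 8 ^ j
  4^k≡2^j*8^j = trans (^-distribˡ-+-* 4 j j) (trans (sym (^-distribʳ-* 4 4 j)) (^-distribʳ-* 2 8 j))
  3∑≤4N : 3 * ∑ xs (λ a → 1 + ind (p a)) ≤ 4 * N
  3∑≤4N = begin
    3 * ∑ xs (λ a → 1 + ind (p a))        ≡⟨ cong (3 *_) (∑-distrib-+ xs (λ _ → 1) (ind ∘ p)) ⟩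
    3 * (∑ xs (λ _ → 1) + ∑ xs (ind ∘ p)) ≡⟨ cong (λ z → 3 * (z + ∑ xs (ind ∘ p))) (trans (∑-const xs 1) (*-identityʳ N)) ⟩
    3 * (N + ∑ xs (ind ∘ p))              ≡⟨ *-distribˡ-+ 3 N _ ⟩
    3 * N + 3 * ∑ xs (ind ∘ p)            ≤⟨ +-monoʳ-≤ (3 * N) 3∑≤N ⟩
    3 * N + N                             ≡⟨ +-comm (3 * N) N ⟩
    4 * N                                 ∎

ind-1≤ᵇ≤ : ∀ s → ind (1 ≤ᵇ s) ≤ s
ind-1≤ᵇ≤ zero    = z≤n
ind-1≤ᵇ≤ (suc s) = s≤s z≤n

∑-ind-≟ : ∀ {b} (p : Fin b) → ∑ (allFin b) (λ o → ind (does (o ≟ p))) ≡ 1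
∑-ind-≟ {suc b} zero =
  trans (∑-allFin-suc b (λ o → ind (does (o ≟ zero)))) (cong suc (∑-zero (allFin b) (λ _ → refl)))
∑-ind-≟ {suc b} (suc p) = trans (∑-allFin-suc b (λ o → ind (does (o ≟ suc p)))) (∑-ind-≟ p)

weight-tabulate : ∀ {n} (f : Fin n → Bool) → weight (Vec.tabulate f) ≡ ∑ (allFin n) (ind ∘ f)
weight-tabulate {zero}  f = refl
weight-tabulate {suc n} f =
  trans (cong (ind (f zero) +_) (weight-tabulate (f ∘ suc))) (sym (∑-allFin-suc n (ind ∘ f)))

module HardInputs {m n t b : ℕ} (tb≤n : t * b ≤ n) (t≤m : t ≤ m) where

  cell : Fin t → Fin b → Fin n
  cell i o = inject≤ (combine i o) tb≤n

  cell-injective : ∀ {i o i′ o′} → cell i o ≡ cell i′ o′ → i ≡ i′ × o ≡ o′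
  cell-injective {i} {o} {i′} {o′} eq = combine-injectiveˡ i o i′ o′ eq′ , combine-injectiveʳ i o i′ o′ eq′
    where eq′ = inject≤-injective tb≤n tb≤n _ _ eq

  target : Vec (Fin b) t → Fin t → Fin n
  target c i = cell i (lookup c i)

  marks : Vec (Fin b) t → Fin n → ℕ
  marks c y = ∑ (allFin t) (λ i → ind (does (y ≟ target c i)))

  weight≤ : ∀ c → weight (Vec.tabulate (λ y → 1 ≤ᵇ marks c y)) ≤ m
  weight≤ c = begin
    weight (Vec.tabulate (λ y → 1 ≤ᵇ marks c y))
      ≡⟨ weight-tabulate (λ y → 1 ≤ᵇ marks c y) ⟩
    ∑ (allFin n) (λ y → ind (1 ≤ᵇ marks c y))
      ≤⟨ ∑-mono-≤ (allFin n) (λ y → ind-1≤ᵇ≤ (marks c y)) ⟩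
    ∑ (allFin n) (marks c)
      ≡⟨ ∑-comm (allFin n) (allFin t) _ ⟩
    ∑ (allFin t) (λ i → ∑ (allFin n) (λ y → ind (does (y ≟ target c i))))
      ≡⟨ ∑-cong (allFin t) (λ i → ∑-ind-≟ (target c i)) ⟩
    ∑ (allFin t) (λ _ → 1)
      ≡⟨ trans (∑-const (allFin t) 1) (trans (*-identityʳ _) (length-allFin t)) ⟩
    t
      ≤⟨ t≤m ⟩
    m ∎
    where open ≤-Reasoning

  input : Vec (Fin b) t → SparseInput m n
  input c = Vec.tabulate (λ y → 1 ≤ᵇ marks c y) , weight≤ c

  input-target : ∀ c i → sparseIndex m n (input c) (target c i) ≡ true
  input-target c i = trans (lookup∘tabulate _ (target c i)) (≤⇒≤ᵇ≡true (begin
    1                                                      ≡⟨ cong ind (sym (dec-true (target c i ≟ target c i) refl)) ⟩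
    ind (does (target c i ≟ target c i))                   ≤⟨ ∈⇒≤∑ (λ i′ → ind (does (target c i ≟ target c i′))) (∈-allFin i) ⟩
    marks c (target c i)                                   ∎))
    where open ≤-Reasoning

  input-elsewhere : ∀ c i o → o ≢ lookup c i → sparseIndex m n (input c) (cell i o) ≡ false
  input-elsewhere c i o o≢ci = trans (lookup∘tabulate _ (cell i o)) (cong (1 ≤ᵇ_) (∑-zero (allFin t) no-mark))
    where
    no-mark : ∀ i′ → ind (does (cell i o ≟ target c i′)) ≡ 0
    no-mark i′ = cong ind (dec-false (cell i o ≟ target c i′) (λ eq → o≢ci (lemma (cell-injective eq))))
      where
      lemma : i ≡ i′ × o ≡ lookup c i′ → o ≡ lookup c i
      lemma (refl , eq) = eq

∏*^count≤^ : ∀ k b (a : Fin k → ℕ) (F : Fin k → Bool) → (∀ i → a i ≤ b) → (∀ i → F i ≡ true → a i ≤ 1) →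
             ∏ k a * b ^ ∑ (allFin k) (ind ∘ F) ≤ b ^ k
∏*^count≤^ zero    b a F a≤b a≤1 = ≤-refl
∏*^count≤^ (suc k) b a F a≤b a≤1 = begin
  a zero * ∏ k (a ∘ suc) * b ^ ∑ (allFin (suc k)) (ind ∘ F)
    ≡⟨ cong (λ e → a zero * ∏ k (a ∘ suc) * b ^ e) (∑-allFin-suc k (ind ∘ F)) ⟩
  a zero * ∏ k (a ∘ suc) * b ^ (ind (F zero) + ∑ (allFin k) (ind ∘ F ∘ suc))
    ≡⟨ cong (a zero * ∏ k (a ∘ suc) *_) (^-distribˡ-+-* b (ind (F zero)) _) ⟩
  a zero * ∏ k (a ∘ suc) * (b ^ ind (F zero) * b ^ ∑ (allFin k) (ind ∘ F ∘ suc))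
    ≡⟨ exchange (a zero) (∏ k (a ∘ suc)) (b ^ ind (F zero)) _ ⟩
  a zero * b ^ ind (F zero) * (∏ k (a ∘ suc) * b ^ ∑ (allFin k) (ind ∘ F ∘ suc))
    ≤⟨ *-mono-≤ head≤b (∏*^count≤^ k b (a ∘ suc) (F ∘ suc) (a≤b ∘ suc) (a≤1 ∘ suc)) ⟩
  b * b ^ k ∎
  where
  open ≤-Reasoning
  exchange : ∀ p q r s → p * q * (r * s) ≡ p * r * (q * s)
  exchange = solve-∀
  head≤b : a zero * b ^ ind (F zero) ≤ b
  head≤b with F zero in eq
  ... | true  = ≤-trans (*-monoˡ-≤ (b * 1) (a≤1 zero eq)) (≤-reflexive (trans (+-identityʳ (b * 1)) (*-identityʳ b)))
  ... | false = ≤-trans (≤-reflexive (*-identityʳ (a zero))) (a≤b zero)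

2^a*8^6a≤9^6a : ∀ a → 2 ^ a * 8 ^ (6 * a) ≤ 9 ^ (6 * a)
2^a*8^6a≤9^6a a = begin
  2 ^ a * 8 ^ (6 * a) ≡⟨ cong (2 ^ a *_) (sym (^-*-assoc 8 6 a)) ⟩
  2 ^ a * (8 ^ 6) ^ a ≡⟨ sym (^-distribʳ-* 2 (8 ^ 6) a) ⟩
  (2 * 8 ^ 6) ^ a     ≤⟨ ^-monoˡ-≤ a (≤ᵇ⇒≤ (2 * 8 ^ 6) (9 ^ 6) _) ⟩
  (9 ^ 6) ^ a         ≡⟨ ^-*-assoc 9 6 a ⟩
  9 ^ (6 * a)         ∎
  where open ≤-Reasoning

+≡+⇒<⇒> : ∀ {a r j} → a + r ≡ j + j → a < j → suc j ≤ r
+≡+⇒<⇒> {a} {r} {j} a+r≡j+j a<j = +-cancelˡ-≤ a _ _ (begin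
  a + suc j ≡⟨ +-suc a j ⟩
  suc a + j ≤⟨ +-monoˡ-≤ j a<j ⟩
  j + j     ≡⟨ sym a+r≡j+j ⟩
  a + r     ∎)
  where open ≤-Reasoning

silent-alice⇒⊥ : {X Y : Set} (F : X → Y → Bool) (P : Protocol X Y) → Complete⅓ F P → Sound⅓ F P →
                 ∀ x x′ y → F x y ≡ true → F x′ y ≡ false →
                 (∀ m₁ rA → alice P x m₁ rA ≡ alice P x′ m₁ rA) → ⊥
silent-alice⇒⊥ {X} F P complete sound x x′ y Fxy Fx′y same = <-irrefl refl (begin-strict
  2 ^ ℓM P * N              <⟨ *-monoʳ-< (2 ^ ℓM P) {{m^n≢0 2 (ℓM P)}} (m<n+m N (m^n>0 2 (ℓA P))) ⟩
  2 ^ ℓM P * (N + N)        ≡⟨ cong (λ z → 2 ^ ℓM P * (N + z)) (sym (+-identityʳ N)) ⟩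
  2 ^ ℓM P * (2 * N)        ≡⟨ cong (_* (2 * N)) (sym (length-bitStrings (ℓM P))) ⟩
  length Coinsᴹ * (2 * N)   ≡⟨ sym (∑-const Coinsᴹ (2 * N)) ⟩
  ∑ Coinsᴹ (λ _ → 2 * N)    ≤⟨ ∑-mono-≤ Coinsᴹ 2N≤3rej ⟩
  ∑ Coinsᴹ (λ rM → 3 * rej rM) ≡⟨ trans (∑-distribˡ-* Coinsᴹ 3 rej) (cong (3 *_) (sym (sumStrings≡∑ (ℓM P) rej))) ⟩
  3 * sumStrings (ℓM P) rej ≤⟨ complete x y Fxy ⟩
  2 ^ (ℓM P + ℓA P)         ≡⟨ ^-distribˡ-+-* 2 (ℓM P) (ℓA P) ⟩
  2 ^ ℓM P * N              ∎)
  where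
  open ≤-Reasoning
  N = 2 ^ ℓA P
  Ω = bitStrings (ℓA P)
  Coinsᴹ = bitStrings (ℓM P)
  run′ : X → Vec Bool (ℓM P) → Vec Bool (ℓA P) → Bool
  run′ z rM = run P z y (h₁ P x rM) (h₂ P x y rM)
  rej acc : Vec Bool (ℓM P) → ℕ
  rej rM = countStrings (ℓA P) (notB ∘ run′ x rM)
  acc rM = countStrings (ℓA P) (run′ x′ rM)
  -- Bob sees the same messages whether Alice holds x or x′.
  acc+rej : ∀ rM → acc rM + rej rM ≡ N
  acc+rej rM = begin-equality
    acc rM + rej rM
      ≡⟨ cong₂ _+_ (sumStrings≡∑ (ℓA P) _) (sumStrings≡∑ (ℓA P) _) ⟩
    ∑ Ω (ind ∘ run′ x′ rM) + ∑ Ω (ind ∘ notB ∘ run′ x rM)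
      ≡⟨ cong (∑ Ω (ind ∘ run′ x′ rM) +_) (∑-cong Ω (λ rA →
           cong (λ a → ind (notB (bob P y (h₂ P x y rM) a rA))) (same (h₁ P x rM) rA))) ⟩
    ∑ Ω (ind ∘ run′ x′ rM) + ∑ Ω (ind ∘ notB ∘ run′ x′ rM)
      ≡⟨ sym (∑-distrib-+ Ω _ _) ⟩
    ∑ Ω (λ rA → ind (run′ x′ rM rA) + ind (notB (run′ x′ rM rA)))
      ≡⟨ ∑-cong Ω (λ rA → ind+ind-notB (run′ x′ rM rA)) ⟩
    ∑ Ω (λ _ → 1)
      ≡⟨ trans (∑-const Ω 1) (trans (*-identityʳ _) (length-bitStrings (ℓA P))) ⟩
    N ∎
  2N≤3rej : ∀ rM → 2 * N ≤ 3 * rej rM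
  2N≤3rej rM = +-cancelˡ-≤ (3 * acc rM) _ _ (begin
    3 * acc rM + 2 * N ≤⟨ +-monoˡ-≤ (2 * N) (sound x′ y Fx′y (h₁ P x rM) (h₂ P x y rM)) ⟩
    N + 2 * N          ≡⟨ cong (λ z → z + 2 * z) (sym (acc+rej rM)) ⟩
    (acc rM + rej rM) + 2 * (acc rM + rej rM) ≡⟨ regroup (acc rM) (rej rM) ⟩
    3 * acc rM + 3 * rej rM ∎)
    where
    regroup : ∀ a r → (a + r) + 2 * (a + r) ≡ 3 * a + 3 * r
    regroup = solve-∀

small-penalty : ∀ u t f → 6 * u + 6 * t * f < 5 * t → f ≡ 0 × 6 * u < 5 * t
small-penalty u t zero    p<5t =
  refl , ≤-trans (s≤s (≤-reflexive (sym (trans (cong (6 * u +_) (*-zeroʳ (6 * t))) (+-identityʳ _))))) p<5t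
small-penalty u t (suc f) p<5t = ⊥-elim (<⇒≱ p<5t (begin
  5 * t                        ≤⟨ *-monoˡ-≤ t (≤ᵇ⇒≤ 5 6 _) ⟩
  6 * t                        ≤⟨ m≤m*n (6 * t) (suc f) ⟩
  6 * t * suc f                ≤⟨ m≤n+m _ (6 * u) ⟩
  6 * u + 6 * t * suc f        ∎))
  where open ≤-Reasoning

most-decided : ∀ d u {t} → d + u ≡ t → 6 * u < 5 * t → suc t ≤ 6 * d
most-decided d u refl 6u<5t = +-cancelʳ-≤ (5 * (d + u)) _ _ (begin
  suc (d + u) + 5 * (d + u) ≡⟨ regroup d u ⟩
  6 * d + suc (6 * u)       ≤⟨ +-monoʳ-≤ (6 * d) 6u<5t ⟩
  6 * d + 5 * (d + u)       ∎)
  where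
  open ≤-Reasoning
  regroup : ∀ d u → suc (d + u) + 5 * (d + u) ≡ 6 * d + suc (6 * u)
  regroup = solve-∀

-- ⌊t/6⌋ + 1 is the least f with t < 6 f.
quorum : ℕ → ℕ
quorum t = suc (t / 6)

quorum-≤ : ∀ t f → suc t ≤ 6 * f → quorum t ≤ f
quorum-≤ t f t<6f with quorum t ≤? f
... | yes q≤f = q≤f
... | no  q≰f = ⊥-elim (<-irrefl refl (≤-trans t<6f (begin
  6 * f       ≤⟨ *-monoʳ-≤ 6 (s≤s⁻¹ (≰⇒> q≰f)) ⟩
  6 * (t / 6) ≡⟨ *-comm 6 (t / 6) ⟩
  t / 6 * 6   ≤⟨ m/n*n≤m t 6 ⟩
  t           ∎)))
  where open ≤-Reasoning

t≤6*quorum : ∀ t → t ≤ 6 * quorum t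
t≤6*quorum t = begin
  t                 ≡⟨ m≡m%n+[m/n]*n t 6 ⟩
  t % 6 + t / 6 * 6 ≤⟨ +-monoˡ-≤ (t / 6 * 6) (<⇒≤ (m%n<n t 6)) ⟩
  6 + t / 6 * 6     ≡⟨ cong (6 +_) (*-comm (t / 6) 6) ⟩
  6 + 6 * (t / 6)   ≡⟨ sym (*-suc 6 (t / 6)) ⟩
  6 * quorum t      ∎
  where open ≤-Reasoning

module BlockBound
  {m n : ℕ} (P : Protocol (SparseInput m n) (Fin n))
  (complete : Complete⅓ (sparseIndex m n) P) (sound : Sound⅓ (sparseIndex m n) P)
  {h v : ℕ}
  (help≤ : ∀ x y rM → 1 + (length (h₁ P x rM) + length (h₂ P x y rM)) ≤ h)
  (message≤ : ∀ x m₁ rA → length (alice P x m₁ rA) ≤ v)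
  (n≤2^h : n ≤ 2 ^ h)
  {t b : ℕ} (tb≤n : t * b ≤ n) (t≤m : t ≤ m) .{{_ : NonZero t}} .{{_ : NonZero b}}
  where

  open HardInputs tb≤n t≤m

  Coins : Set
  Coins = Vec Bool (ℓA P)

  j k N : ℕ
  j = 6 * (h + h + 6)
  k = j + j
  N = 2 ^ ℓA P

  Ω : List Coins
  Ω = bitStrings (ℓA P)

  Ωᵏ : List (Vec Coins k)
  Ωᵏ = allVecs Ω k

  codes : List (Vec (Fin b) t)
  codes = allVecs (allFin b) t

  helps : List (List Bool)
  helps = lists≤ h

  transcripts : List (Vec (List Bool) k)
  transcripts = allVecs (lists≤ v) k

  length-Ω : length Ω ≡ N
  length-Ω = length-bitStrings (ℓA P)

  length-Ωᵏ : length Ωᵏ ≡ N ^ k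
  length-Ωᵏ = trans (length-allVecs Ω k) (cong (_^ k) length-Ω)

  rejections : Vec (Fin b) t → Fin t → Vec Bool (ℓM P) → ℕ
  rejections c i rM = countStrings (ℓA P) (λ rA →
    notB (run P (input c) (target c i) (h₁ P (input c) rM) (h₂ P (input c) (target c i) rM) rA))

  merlin-coins : ∀ c → ∃[ rM ] 3 * ∑ (allFin t) (λ i → rejections c i rM) ≤ t * N
  merlin-coins c = ∑-average Coinsᴹ _ (t * N) 1≤#coins (begin
    ∑ Coinsᴹ (λ rM → 3 * ∑ (allFin t) (λ i → rejections c i rM))
      ≡⟨ ∑-distribˡ-* Coinsᴹ 3 _ ⟩
    3 * ∑ Coinsᴹ (λ rM → ∑ (allFin t) (λ i → rejections c i rM))
      ≡⟨ cong (3 *_) (∑-comm Coinsᴹ (allFin t) _) ⟩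
    3 * ∑ (allFin t) (λ i → ∑ Coinsᴹ (rejections c i))
      ≡⟨ sym (∑-distribˡ-* (allFin t) 3 _) ⟩
    ∑ (allFin t) (λ i → 3 * ∑ Coinsᴹ (rejections c i))
      ≤⟨ ∑-≤-length* (allFin t) _ complete-at ⟩
    length (allFin t) * 2 ^ (ℓM P + ℓA P)
      ≡⟨ cong₂ _*_ (length-allFin t) (^-distribˡ-+-* 2 (ℓM P) (ℓA P)) ⟩
    t * (2 ^ ℓM P * N)
      ≡⟨ swap t (2 ^ ℓM P) N ⟩
    2 ^ ℓM P * (t * N)
      ≡⟨ cong (_* (t * N)) (sym (length-bitStrings (ℓM P))) ⟩
    length Coinsᴹ * (t * N) ∎)
    where
    open ≤-Reasoning
    Coinsᴹ = bitStrings (ℓM P)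
    1≤#coins : 1 ≤ length Coinsᴹ
    1≤#coins = subst (1 ≤_) (sym (length-bitStrings (ℓM P))) (m^n>0 2 (ℓM P))
    complete-at : ∀ i → 3 * ∑ Coinsᴹ (rejections c i) ≤ 2 ^ (ℓM P + ℓA P)
    complete-at i = subst (λ z → 3 * z ≤ 2 ^ (ℓM P + ℓA P)) (sumStrings≡∑ (ℓM P) (rejections c i))
                          (complete (input c) (target c i) (input-target c i))
    swap : ∀ a b c → a * (b * c) ≡ b * (a * c)
    swap = solve-∀

  rM* : Vec (Fin b) t → Vec Bool (ℓM P)
  rM* c = proj₁ (merlin-coins c)

  help₁ : Vec (Fin b) t → List Bool
  help₁ c = h₁ P (input c) (rM* c)

  transcript : Vec (Fin b) t → Vec Coins k → Vec (List Bool) k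
  transcript c R = Vec.map (alice P (input c) (help₁ c)) R

  acceptances : Fin n → List Bool → ∀ {ℓ} → Vec (List Bool) ℓ → Vec Coins ℓ → ℕ
  acceptances y m₂ []       []      = 0
  acceptances y m₂ (a ∷ Pr) (r ∷ R) = ind (bob P y m₂ a r) + acceptances y m₂ Pr R

  acceptances-transcript : ∀ c y m₂ (R : Vec Coins k) →
    acceptances y m₂ (transcript c R) R ≡ hits (λ rA → run P (input c) y (help₁ c) m₂ rA) R
  acceptances-transcript c y m₂ = go
    where
    go : ∀ {ℓ} (R : Vec Coins ℓ) →
         acceptances y m₂ (Vec.map (alice P (input c) (help₁ c)) R) R ≡ hits (λ rA → run P (input c) y (help₁ c) m₂ rA) R
    go []      = refl
    go (r ∷ R) = cong (ind (run P (input c) y (help₁ c) m₂ r) +_) (go R)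

  -- The decoder sees the code only through Alice's messages Pr; this is what the final count uses.
  decode : Vec (List Bool) k → Vec Coins k → Fin t → Fin b → Bool
  decode Pr R i o = 1 ≤ᵇ ∑ helps (λ m₂ → ind (j ≤ᵇ acceptances (cell i o) m₂ Pr R))

  misses : Vec (Fin b) t → Vec Coins k → ℕ
  misses c R = ∑ (allFin t) (λ i → ind (notB (decode (transcript c R) R i (lookup c i))))

  rivals : Vec (List Bool) k → Vec Coins k → Fin t → Fin b → ℕ
  rivals Pr R i o = ∑ (allFin b) (λ o′ → ind (decode Pr R i o′ ∧ notB (does (o′ ≟ o))))

  falseAlarms : Vec (Fin b) t → Vec Coins k → ℕ
  falseAlarms c R = ∑ (allFin t) (λ i → rivals (transcript c R) R i (lookup c i))

  -- A code with penalty < 5t has no false alarm and misses fewer than 5t/6 of its own cells.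
  penalty : Vec (Fin b) t → Vec Coins k → ℕ
  penalty c R = 6 * misses c R + 6 * t * falseAlarms c R

  module _ (c : Vec (Fin b) t) (i : Fin t) where

    private
      honest₂ : List Bool
      honest₂ = h₂ P (input c) (target c i) (rM* c)

      accepts : Coins → Bool
      accepts = run P (input c) (target c i) (help₁ c) honest₂

    decode-target : ∀ R → j ≤ hits accepts R → decode (transcript c R) R i (lookup c i) ≡ true
    decode-target R j≤hits = ≤⇒≤ᵇ≡true (begin
      1
        ≡⟨ cong ind (sym (≤⇒≤ᵇ≡true (subst (j ≤_) (sym (acceptances-transcript c (target c i) honest₂ R)) j≤hits))) ⟩
      ind (j ≤ᵇ acceptances (target c i) honest₂ (transcript c R) R)
        ≤⟨ ∈⇒≤∑ (λ m₂ → ind (j ≤ᵇ acceptances (target c i) m₂ (transcript c R) R)) (∈-lists≤ h honest₂ honest₂≤h) ⟩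
      ∑ helps (λ m₂ → ind (j ≤ᵇ acceptances (target c i) m₂ (transcript c R) R)) ∎)
      where
      open ≤-Reasoning
      honest₂≤h : length honest₂ ≤ h
      honest₂≤h = ≤-trans (m≤n+m _ _) (≤-trans (n≤1+n _) (help≤ (input c) (target c i) (rM* c)))

    miss⇒rejections : ∀ R → ind (notB (decode (transcript c R) R i (lookup c i)))
                              ≤ ind (suc j ≤ᵇ hits (notB ∘ accepts) R)
    miss⇒rejections R = ind-notB≤ λ decoded≡false → ≤-reflexive (cong ind (sym (≤⇒≤ᵇ≡true
      (+≡+⇒<⇒> (hits+hits-notB accepts R) (≰⇒> (λ j≤hits → case trans (sym decoded≡false) (decode-target R j≤hits) of λ ()))))))

    ∑-misses-at : N * ∑ Ωᵏ (λ R → ind (notB (decode (transcript c R) R i (lookup c i))))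
                    ≤ 2 * rejections c i (rM* c) * N ^ k
    ∑-misses-at = begin
      N * ∑ Ωᵏ (λ R → ind (notB (decode (transcript c R) R i (lookup c i))))
        ≤⟨ *-monoʳ-≤ N (∑-mono-≤ Ωᵏ miss⇒rejections) ⟩
      N * ∑ Ωᵏ (λ R → ind (suc j ≤ᵇ hits (notB ∘ accepts) R))
        ≡⟨ cong (_* ∑ Ωᵏ (λ R → ind (suc j ≤ᵇ hits (notB ∘ accepts) R))) (sym length-Ω) ⟩
      length Ω * ∑ Ωᵏ (λ R → ind (suc j ≤ᵇ hits (notB ∘ accepts) R))
        ≤⟨ markov Ω (notB ∘ accepts) j ⟩
      2 * ∑ Ω (ind ∘ notB ∘ accepts) * length Ω ^ k
        ≡⟨ cong₂ (λ r M → 2 * r * M ^ k) (sym (sumStrings≡∑ (ℓA P) (ind ∘ notB ∘ accepts))) length-Ω ⟩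
      2 * rejections c i (rM* c) * N ^ k ∎
      where open ≤-Reasoning

  ∑-misses : ∀ c → 3 * ∑ Ωᵏ (misses c) ≤ 2 * t * N ^ k
  ∑-misses c = *-cancelˡ-≤ N {{m^n≢0 2 (ℓA P)}} (begin
    N * (3 * ∑ Ωᵏ (misses c))
      ≡⟨ cong (λ z → N * (3 * z)) (∑-comm Ωᵏ (allFin t) _) ⟩
    N * (3 * ∑ (allFin t) (λ i → ∑ Ωᵏ (miss i)))
      ≡⟨ swap N 3 _ ⟩
    3 * (N * ∑ (allFin t) (λ i → ∑ Ωᵏ (miss i)))
      ≡⟨ cong (3 *_) (sym (∑-distribˡ-* (allFin t) N _)) ⟩
    3 * ∑ (allFin t) (λ i → N * ∑ Ωᵏ (miss i))
      ≤⟨ *-monoʳ-≤ 3 (∑-mono-≤ (allFin t) (∑-misses-at c)) ⟩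
    3 * ∑ (allFin t) (λ i → 2 * rejections c i (rM* c) * N ^ k)
      ≡⟨ cong (3 *_) (∑-cong (allFin t) (λ i → reorder (rejections c i (rM* c)) (N ^ k))) ⟩
    3 * ∑ (allFin t) (λ i → 2 * N ^ k * rejections c i (rM* c))
      ≡⟨ cong (3 *_) (∑-distribˡ-* (allFin t) (2 * N ^ k) _) ⟩
    3 * (2 * N ^ k * ∑ (allFin t) (λ i → rejections c i (rM* c)))
      ≡⟨ swap 3 (2 * N ^ k) _ ⟩
    2 * N ^ k * (3 * ∑ (allFin t) (λ i → rejections c i (rM* c)))
      ≤⟨ *-monoʳ-≤ (2 * N ^ k) (proj₂ (merlin-coins c)) ⟩
    2 * N ^ k * (t * N)
      ≡⟨ collect N t (N ^ k) ⟩
    N * (2 * t * N ^ k) ∎)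
    where
    open ≤-Reasoning
    miss : Fin t → Vec Coins k → ℕ
    miss i R = ind (notB (decode (transcript c R) R i (lookup c i)))
    swap : ∀ a b c → a * (b * c) ≡ b * (a * c)
    swap = solve-∀
    reorder : ∀ r q → 2 * r * q ≡ 2 * q * r
    reorder = solve-∀
    collect : ∀ n t q → 2 * q * (t * n) ≡ n * (2 * t * q)
    collect = solve-∀

  ∑-decode-elsewhere : ∀ c i o → o ≢ lookup c i →
    9 ^ j * ∑ Ωᵏ (λ R → ind (decode (transcript c R) R i o)) ≤ length helps * (8 ^ j * N ^ k)
  ∑-decode-elsewhere c i o o≢ci = begin
    9 ^ j * ∑ Ωᵏ (λ R → ind (decode (transcript c R) R i o))
      ≤⟨ *-monoʳ-≤ (9 ^ j) (∑-mono-≤ Ωᵏ (λ R → ind-1≤ᵇ≤ _)) ⟩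
    9 ^ j * ∑ Ωᵏ (λ R → ∑ helps (λ m₂ → accepts-often m₂ R))
      ≡⟨ cong (9 ^ j *_) (∑-comm Ωᵏ helps _) ⟩
    9 ^ j * ∑ helps (λ m₂ → ∑ Ωᵏ (accepts-often m₂))
      ≡⟨ sym (∑-distribˡ-* helps (9 ^ j) _) ⟩
    ∑ helps (λ m₂ → 9 ^ j * ∑ Ωᵏ (accepts-often m₂))
      ≤⟨ ∑-≤-length* helps _ chernoff-at ⟩
    length helps * (8 ^ j * N ^ k) ∎
    where
    open ≤-Reasoning
    accepts : List Bool → Coins → Bool
    accepts m₂ = run P (input c) (cell i o) (help₁ c) m₂
    accepts-often : List Bool → Vec Coins k → ℕ
    accepts-often m₂ R = ind (j ≤ᵇ acceptances (cell i o) m₂ (transcript c R) R)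
    chernoff-at : ∀ m₂ → 9 ^ j * ∑ Ωᵏ (accepts-often m₂) ≤ 8 ^ j * N ^ k
    chernoff-at m₂ = begin
      9 ^ j * ∑ Ωᵏ (accepts-often m₂)
        ≡⟨ cong (9 ^ j *_) (∑-cong Ωᵏ (λ R → cong (λ a → ind (j ≤ᵇ a)) (acceptances-transcript c (cell i o) m₂ R))) ⟩
      9 ^ j * ∑ Ωᵏ (λ R → ind (j ≤ᵇ hits (accepts m₂) R))
        ≤⟨ chernoff Ω (accepts m₂) j sound-at ⟩
      8 ^ j * length Ω ^ k
        ≡⟨ cong (λ M → 8 ^ j * M ^ k) length-Ω ⟩
      8 ^ j * N ^ k ∎
      where
      sound-at : 3 * ∑ Ω (ind ∘ accepts m₂) ≤ length Ω
      sound-at = subst₂ (λ a M → 3 * a ≤ M) (sumStrings≡∑ (ℓA P) (ind ∘ accepts m₂)) (sym length-Ω)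
                        (sound (input c) (cell i o) (input-elsewhere c i o o≢ci) (help₁ c) m₂)

  ∑-alarm : ∀ c i o →
    9 ^ j * ∑ Ωᵏ (λ R → ind (decode (transcript c R) R i o ∧ notB (does (o ≟ lookup c i))))
      ≤ length helps * (8 ^ j * N ^ k)
  ∑-alarm c i o = by-cases (o ≟ lookup c i)
    where
    by-cases : (o≟ci : Dec (o ≡ lookup c i)) →
      9 ^ j * ∑ Ωᵏ (λ R → ind (decode (transcript c R) R i o ∧ notB (does o≟ci))) ≤ length helps * (8 ^ j * N ^ k)
    by-cases (yes _) = ≤-trans (≤-reflexive (trans
      (cong (9 ^ j *_) (∑-zero Ωᵏ (λ R → cong ind (∧-zeroʳ (decode (transcript c R) R i o))))) (*-zeroʳ (9 ^ j)))) z≤n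
    by-cases (no o≢ci) = ≤-trans
      (≤-reflexive (cong (9 ^ j *_) (∑-cong Ωᵏ (λ R → cong ind (∧-identityʳ (decode (transcript c R) R i o))))))
      (∑-decode-elsewhere c i o o≢ci)

  #cells×#helps≤ : 24 * (t * (b * length helps)) ≤ 2 ^ (h + h + 6)
  #cells×#helps≤ = begin
    24 * (t * (b * length helps)) ≡⟨ cong (24 *_) (sym (*-assoc t b (length helps))) ⟩
    24 * (t * b * length helps)   ≤⟨ *-monoʳ-≤ 24 (*-mono-≤ (≤-trans tb≤n n≤2^h) #helps≤) ⟩
    24 * (2 ^ h * 2 ^ suc h)      ≡⟨ cong (24 *_) (sym (^-distribˡ-+-* 2 h (suc h))) ⟩
    24 * 2 ^ (h + suc h)          ≡⟨ cong (λ e → 24 * 2 ^ e) (+-suc h h) ⟩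
    24 * (2 * 2 ^ (h + h))        ≡⟨ sym (*-assoc 24 2 (2 ^ (h + h))) ⟩
    48 * 2 ^ (h + h)              ≤⟨ *-monoˡ-≤ (2 ^ (h + h)) (≤ᵇ⇒≤ 48 64 _) ⟩
    64 * 2 ^ (h + h)              ≡⟨ *-comm 64 (2 ^ (h + h)) ⟩
    2 ^ (h + h) * 2 ^ 6           ≡⟨ sym (^-distribˡ-+-* 2 (h + h) 6) ⟩
    2 ^ (h + h + 6)               ∎
    where
    open ≤-Reasoning
    #helps≤ : length helps ≤ 2 ^ suc h
    #helps≤ = ≤-trans (n≤1+n _) (≤-reflexive (length-lists≤ h))

  -- The union bound over the 2^(2h+6) (cell, help message) pairs is paid for by the
  -- Chernoff factor (8/9)^j, since j = 6(2h+6) and (9/8)^6 > 2.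
  ∑-falseAlarms : ∀ c → 24 * ∑ Ωᵏ (falseAlarms c) ≤ N ^ k
  ∑-falseAlarms c = *-cancelˡ-≤ (9 ^ j) {{m^n≢0 9 j}} (begin
    9 ^ j * (24 * ∑ Ωᵏ (falseAlarms c))
      ≡⟨ swap (9 ^ j) 24 _ ⟩
    24 * (9 ^ j * ∑ Ωᵏ (falseAlarms c))
      ≡⟨ cong (λ z → 24 * (9 ^ j * z)) (trans (∑-comm Ωᵏ (allFin t) _) (∑-cong (allFin t) (λ i → ∑-comm Ωᵏ (allFin b) _))) ⟩
    24 * (9 ^ j * ∑ (allFin t) (λ i → ∑ (allFin b) (λ o → ∑ Ωᵏ (alarm i o))))
      ≡⟨ cong (24 *_) (trans (sym (∑-distribˡ-* (allFin t) (9 ^ j) _))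
                             (∑-cong (allFin t) (λ i → sym (∑-distribˡ-* (allFin b) (9 ^ j) _)))) ⟩
    24 * ∑ (allFin t) (λ i → ∑ (allFin b) (λ o → 9 ^ j * ∑ Ωᵏ (alarm i o)))
      ≤⟨ *-monoʳ-≤ 24 (∑-≤-length* (allFin t) _ (λ i → ∑-≤-length* (allFin b) _ (∑-alarm c i))) ⟩
    24 * (length (allFin t) * (length (allFin b) * (length helps * (8 ^ j * N ^ k))))
      ≡⟨ cong₂ (λ t′ b′ → 24 * (t′ * (b′ * (length helps * (8 ^ j * N ^ k))))) (length-allFin t) (length-allFin b) ⟩
    24 * (t * (b * (length helps * (8 ^ j * N ^ k))))
      ≡⟨ reassociate 24 t b (length helps) (8 ^ j) (N ^ k) ⟩
    24 * (t * (b * length helps)) * 8 ^ j * N ^ k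
      ≤⟨ *-monoˡ-≤ (N ^ k) (*-monoˡ-≤ (8 ^ j) #cells×#helps≤) ⟩
    2 ^ (h + h + 6) * 8 ^ j * N ^ k
      ≤⟨ *-monoˡ-≤ (N ^ k) (2^a*8^6a≤9^6a (h + h + 6)) ⟩
    9 ^ j * N ^ k ∎)
    where
    open ≤-Reasoning
    alarm : Fin t → Fin b → Vec Coins k → ℕ
    alarm i o R = ind (decode (transcript c R) R i o ∧ notB (does (o ≟ lookup c i)))
    swap : ∀ a b c → a * (b * c) ≡ b * (a * c)
    swap = solve-∀
    reassociate : ∀ a t b l e q → a * (t * (b * (l * (e * q)))) ≡ a * (t * (b * l)) * e * q
    reassociate = solve-∀

  ∑-penalty : ∀ c → 12 * ∑ Ωᵏ (penalty c) ≤ 51 * t * N ^ k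
  ∑-penalty c = begin
    12 * ∑ Ωᵏ (penalty c)
      ≡⟨ cong (12 *_) (trans (∑-distrib-+ Ωᵏ (λ R → 6 * misses c R) (λ R → 6 * t * falseAlarms c R))
                             (cong₂ _+_ (∑-distribˡ-* Ωᵏ 6 (misses c)) (∑-distribˡ-* Ωᵏ (6 * t) (falseAlarms c)))) ⟩
    12 * (6 * ∑ Ωᵏ (misses c) + 6 * t * ∑ Ωᵏ (falseAlarms c))
      ≡⟨ regroup (∑ Ωᵏ (misses c)) t (∑ Ωᵏ (falseAlarms c)) ⟩
    24 * (3 * ∑ Ωᵏ (misses c)) + 3 * t * (24 * ∑ Ωᵏ (falseAlarms c))
      ≤⟨ +-mono-≤ (*-monoʳ-≤ 24 (∑-misses c)) (*-monoʳ-≤ (3 * t) (∑-falseAlarms c)) ⟩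
    24 * (2 * t * N ^ k) + 3 * t * N ^ k
      ≡⟨ collect t (N ^ k) ⟩
    51 * t * N ^ k ∎
    where
    open ≤-Reasoning
    regroup : ∀ u t f → 12 * (6 * u + 6 * t * f) ≡ 24 * (3 * u) + 3 * t * (24 * f)
    regroup = solve-∀
    collect : ∀ t q → 24 * (2 * t * q) + 3 * t * q ≡ 51 * t * q
    collect = solve-∀

  public-coins : ∃[ R ] 12 * ∑ codes (λ c → penalty c R) ≤ 51 * t * length codes
  public-coins = ∑-average Ωᵏ _ (51 * t * length codes) 1≤#Ωᵏ (begin
    ∑ Ωᵏ (λ R → 12 * ∑ codes (λ c → penalty c R)) ≡⟨ ∑-distribˡ-* Ωᵏ 12 _ ⟩
    12 * ∑ Ωᵏ (λ R → ∑ codes (λ c → penalty c R)) ≡⟨ cong (12 *_) (∑-comm Ωᵏ codes _) ⟩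
    12 * ∑ codes (λ c → ∑ Ωᵏ (penalty c))         ≡⟨ sym (∑-distribˡ-* codes 12 _) ⟩
    ∑ codes (λ c → 12 * ∑ Ωᵏ (penalty c))         ≤⟨ ∑-≤-length* codes _ ∑-penalty ⟩
    length codes * (51 * t * N ^ k)               ≡⟨ cong (λ M → length codes * (51 * t * M)) (sym length-Ωᵏ) ⟩
    length codes * (51 * t * length Ωᵏ)           ≡⟨ swap (length codes) t (length Ωᵏ) ⟩
    length Ωᵏ * (51 * t * length codes)           ∎)
    where
    open ≤-Reasoning
    1≤#Ωᵏ : 1 ≤ length Ωᵏ
    1≤#Ωᵏ = subst (1 ≤_) (sym length-Ωᵏ) (m^n>0 N {{m^n≢0 2 (ℓA P)}} k)
    swap : ∀ a t w → a * (51 * t * w) ≡ w * (51 * t * a)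
    swap = solve-∀

  R₀ : Vec Coins k
  R₀ = proj₁ public-coins

  isBad : Vec (Fin b) t → Bool
  isBad c = 5 * t ≤ᵇ penalty c R₀

  #good : ℕ
  #good = ∑ codes (λ c → ind (notB (isBad c)))

  #good≥ : 9 * length codes ≤ 60 * #good
  #good≥ = +-cancelʳ-≤ (51 * length codes) _ _ (begin
    9 * length codes + 51 * length codes ≡⟨ sym (*-distribʳ-+ (length codes) 9 51) ⟩
    60 * length codes                    ≡⟨ cong (60 *_) (sym #good+#bad) ⟩
    60 * (#good + #bad)                  ≡⟨ *-distribˡ-+ 60 #good #bad ⟩
    60 * #good + 60 * #bad               ≤⟨ +-monoʳ-≤ (60 * #good) 60#bad≤ ⟩
    60 * #good + 51 * length codes       ∎)
    where
    open ≤-Reasoning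
    #bad = ∑ codes (ind ∘ isBad)
    #good+#bad : #good + #bad ≡ length codes
    #good+#bad = trans (sym (∑-distrib-+ codes _ _))
      (trans (∑-cong codes (λ c → trans (+-comm _ (ind (isBad c))) (ind+ind-notB (isBad c))))
             (trans (∑-const codes 1) (*-identityʳ _)))
    60#bad≤ : 60 * #bad ≤ 51 * length codes
    60#bad≤ = *-cancelˡ-≤ t (begin
      t * (60 * #bad)                         ≡⟨ regroup t #bad ⟩
      12 * (5 * t * #bad)                     ≡⟨ cong (12 *_) (sym (∑-distribˡ-* codes (5 * t) _)) ⟩
      12 * ∑ codes (λ c → 5 * t * ind (isBad c))
        ≤⟨ *-monoʳ-≤ 12 (∑-mono-≤ codes (λ c → *-ind-≤ᵇ-≤ (λ z → z) (λ a≤b → a≤b) (5 * t) (penalty c R₀))) ⟩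
      12 * ∑ codes (λ c → penalty c R₀)       ≤⟨ proj₂ public-coins ⟩
      51 * t * length codes                   ≡⟨ regroup′ t (length codes) ⟩
      t * (51 * length codes)                 ∎)
      where
      regroup : ∀ t b → t * (60 * b) ≡ 12 * (5 * t * b)
      regroup = solve-∀
      regroup′ : ∀ t a → 51 * t * a ≡ t * (51 * a)
      regroup′ = solve-∀

  decided : Vec (List Bool) k → Fin t → Bool
  decided Pr i = 1 ≤ᵇ ∑ (allFin b) (λ o → ind (decode Pr R₀ i o))

  #decided : Vec (List Bool) k → ℕ
  #decided Pr = ∑ (allFin t) (ind ∘ decided Pr)

  unrivalled : Vec (List Bool) k → Fin t → Fin b → Bool
  unrivalled Pr i o = notB (1 ≤ᵇ rivals Pr R₀ i o)

  options : Vec (List Bool) k → Fin t → ℕ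
  options Pr i = ∑ (allFin b) (ind ∘ unrivalled Pr i)

  explains : Vec (Fin b) t → Vec (List Bool) k → ℕ
  explains c Pr = ind (suc t ≤ᵇ 6 * #decided Pr) * ∏ᵛ (λ i o → ind (unrivalled Pr i o)) c

  ind-decode≤ind-decided : ∀ Pr i o → ind (decode Pr R₀ i o) ≤ ind (decided Pr i)
  ind-decode≤ind-decided Pr i o = ind≤ind λ decoded → ≤⇒≤ᵇ≡true (begin
    1                                             ≡⟨ cong ind (sym decoded) ⟩
    ind (decode Pr R₀ i o)                        ≤⟨ ∈⇒≤∑ (λ o′ → ind (decode Pr R₀ i o′)) (∈-allFin o) ⟩
    ∑ (allFin b) (λ o′ → ind (decode Pr R₀ i o′)) ∎)
    where open ≤-Reasoning

  good⇒explained : ∀ c → isBad c ≡ false → explains c (transcript c R₀) ≡ 1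
  good⇒explained c good = cong₂ _*_ (cong ind (≤⇒≤ᵇ≡true many-decided))
                                    (∏ᵛ-one (λ i o → ind (unrivalled Pr i o)) c target-unrivalled)
    where
    Pr = transcript c R₀
    small = small-penalty (misses c R₀) t (falseAlarms c R₀) (≤ᵇ≡false⇒> (5 * t) (penalty c R₀) good)
    target-unrivalled : ∀ i → ind (unrivalled Pr i (lookup c i)) ≡ 1
    target-unrivalled i = cong (λ r → ind (notB (1 ≤ᵇ r))) (n≤0⇒n≡0 (≤-trans
      (∈⇒≤∑ (λ i′ → rivals Pr R₀ i′ (lookup c i′)) (∈-allFin i)) (≤-reflexive (proj₁ small))))
    hit : Fin t → ℕ
    hit i = ind (decode Pr R₀ i (lookup c i))
    hits+misses : ∑ (allFin t) hit + misses c R₀ ≡ t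
    hits+misses = trans (sym (∑-distrib-+ (allFin t) hit (λ i → ind (notB (decode Pr R₀ i (lookup c i))))))
      (trans (∑-cong (allFin t) (λ i → ind+ind-notB (decode Pr R₀ i (lookup c i))))
             (trans (∑-const (allFin t) 1) (trans (*-identityʳ _) (length-allFin t))))
    many-decided : suc t ≤ 6 * #decided Pr
    many-decided = ≤-trans (most-decided (∑ (allFin t) hit) (misses c R₀) hits+misses (proj₂ small))
      (*-monoʳ-≤ 6 (∑-mono-≤ (allFin t) (λ i → ind-decode≤ind-decided Pr i (lookup c i))))

  options≤b : ∀ Pr i → options Pr i ≤ b
  options≤b Pr i = ≤-trans (∑-≤-length* (allFin b) 1 (λ o → ind≤1 (unrivalled Pr i o)))
                           (≤-reflexive (trans (*-identityʳ _) (length-allFin b)))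

  unrivalled-only : ∀ Pr i {o′} → decode Pr R₀ i o′ ≡ true → ∀ o → ind (unrivalled Pr i o) ≤ ind (does (o ≟ o′))
  unrivalled-only Pr i {o′} decoded o = by-cases (o ≟ o′)
    where
    by-cases : (o≟o′ : Dec (o ≡ o′)) → ind (unrivalled Pr i o) ≤ ind (does o≟o′)
    by-cases (yes _)    = ind≤1 (unrivalled Pr i o)
    by-cases (no  o≢o′) = ≤-trans (≤-reflexive (cong (ind ∘ notB) (≤⇒≤ᵇ≡true (begin
      1                                                 ≡⟨ cong₂ (λ d e → ind (d ∧ notB e)) (sym decoded)
                                                                 (sym (dec-false (o′ ≟ o) (o≢o′ ∘ sym))) ⟩
      ind (decode Pr R₀ i o′ ∧ notB (does (o′ ≟ o)))    ≤⟨ ∈⇒≤∑ (λ o″ → ind (decode Pr R₀ i o″ ∧ notB (does (o″ ≟ o))))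
                                                                (∈-allFin o′) ⟩
      rivals Pr R₀ i o                                  ∎)))) z≤n
      where open ≤-Reasoning

  options≤1 : ∀ Pr i → decided Pr i ≡ true → options Pr i ≤ 1
  options≤1 Pr i is-decided =
    ≤-trans (∑-mono-≤ (allFin b) (unrivalled-only Pr i (1≤ind⇒≡true (proj₂ witness)))) (≤-reflexive (∑-ind-≟ (proj₁ witness)))
    where
    witness = ∑-positive⇒∃ (allFin b) (λ o → ind (decode Pr R₀ i o)) (≤ᵇ≡true⇒≤ 1 _ is-decided)

  ∑-explains : ∀ Pr → b ^ quorum t * ∑ codes (λ c → explains c Pr) ≤ b ^ t
  ∑-explains Pr = begin
    b ^ quorum t * ∑ codes (λ c → explains c Pr)
      ≡⟨ cong (b ^ quorum t *_) (trans (∑-distribˡ-* codes (ind many) (∏ᵛ (λ i o → ind (unrivalled Pr i o))))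
                                       (cong (ind many *_) (∑-allVecs-∏ᵛ (allFin b) t (λ i o → ind (unrivalled Pr i o))))) ⟩
    b ^ quorum t * (ind many * product)
      ≡⟨ swap (b ^ quorum t) (ind many) product ⟩
    ind many * (b ^ quorum t * product)
      ≤⟨ ind*≤ {many} (λ is-many → begin
           b ^ quorum t * product    ≤⟨ *-monoˡ-≤ product (^-monoʳ-≤ b (quorum-≤ t (#decided Pr) (≤ᵇ≡true⇒≤ (suc t) (6 * #decided Pr) is-many))) ⟩
           b ^ #decided Pr * product ≡⟨ *-comm _ product ⟩
           product * b ^ #decided Pr ≤⟨ ∏*^count≤^ t b (options Pr) (decided Pr) (options≤b Pr) (options≤1 Pr) ⟩
           b ^ t                     ∎) ⟩
    b ^ t ∎
    where
    open ≤-Reasoning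
    many = suc t ≤ᵇ 6 * #decided Pr
    product = ∏ t (options Pr)
    swap : ∀ a b c → a * (b * c) ≡ b * (a * c)
    swap = solve-∀

  transcript∈ : ∀ c → transcript c R₀ ∈ transcripts
  transcript∈ c = ∈-allVecs (lists≤ v) (transcript c R₀) (λ l →
    subst (_∈ lists≤ v) (sym (lookup-map l (alice P (input c) (help₁ c)) R₀))
          (∈-lists≤ v _ (message≤ (input c) (help₁ c) (lookup R₀ l))))

  b^quorum*#good≤ : b ^ quorum t * #good ≤ length transcripts * b ^ t
  b^quorum*#good≤ = begin
    b ^ quorum t * #good
      ≤⟨ *-monoʳ-≤ (b ^ quorum t) (∑-mono-≤ codes good⇒transcript-explains) ⟩
    b ^ quorum t * ∑ codes (λ c → ∑ transcripts (explains c))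
      ≡⟨ cong (b ^ quorum t *_) (∑-comm codes transcripts explains) ⟩
    b ^ quorum t * ∑ transcripts (λ Pr → ∑ codes (λ c → explains c Pr))
      ≡⟨ sym (∑-distribˡ-* transcripts (b ^ quorum t) _) ⟩
    ∑ transcripts (λ Pr → b ^ quorum t * ∑ codes (λ c → explains c Pr))
      ≤⟨ ∑-≤-length* transcripts (b ^ t) ∑-explains ⟩
    length transcripts * b ^ t ∎
    where
    open ≤-Reasoning
    good⇒transcript-explains : ∀ c → ind (notB (isBad c)) ≤ ∑ transcripts (explains c)
    good⇒transcript-explains c = ind-notB≤ λ good →
      ≤-trans (≤-reflexive (sym (good⇒explained c good))) (∈⇒≤∑ (explains c) (transcript∈ c))

  blocks-bound : b ^ t ≤ (7 * (2 ^ suc v) ^ k) ^ 6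
  blocks-bound = begin
    b ^ t                  ≤⟨ ^-monoʳ-≤ b (t≤6*quorum t) ⟩
    b ^ (6 * quorum t)     ≡⟨ trans (cong (b ^_) (*-comm 6 (quorum t))) (sym (^-*-assoc b (quorum t) 6)) ⟩
    (b ^ quorum t) ^ 6     ≤⟨ ^-monoˡ-≤ 6 (≤-trans b^quorum≤ (*-monoʳ-≤ 7 #transcripts≤)) ⟩
    (7 * (2 ^ suc v) ^ k) ^ 6 ∎
    where
    open ≤-Reasoning
    #transcripts≤ : length transcripts ≤ (2 ^ suc v) ^ k
    #transcripts≤ = ≤-trans (≤-reflexive (length-allVecs (lists≤ v) k))
                            (^-monoˡ-≤ k (≤-trans (n≤1+n _) (≤-reflexive (length-lists≤ v))))
    #codes : length codes ≡ b ^ t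
    #codes = trans (length-allVecs (allFin b) t) (cong (_^ t) (length-allFin b))
    -- 9/60 of the codes are good, and each transcript explains at most b^(t - quorum) of them.
    b^quorum≤ : b ^ quorum t ≤ 7 * length transcripts
    b^quorum≤ = *-cancelˡ-≤ 9 (*-cancelˡ-≤ (b ^ t) {{m^n≢0 b t}} (begin
      b ^ t * (9 * b ^ quorum t)         ≡⟨ swap (b ^ t) 9 (b ^ quorum t) ⟩
      b ^ quorum t * (9 * b ^ t)         ≡⟨ cong (λ z → b ^ quorum t * (9 * z)) (sym #codes) ⟩
      b ^ quorum t * (9 * length codes)  ≤⟨ *-monoʳ-≤ (b ^ quorum t) #good≥ ⟩
      b ^ quorum t * (60 * #good)        ≡⟨ swap′ (b ^ quorum t) 60 #good ⟩
      60 * (b ^ quorum t * #good)        ≤⟨ *-monoʳ-≤ 60 b^quorum*#good≤ ⟩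
      60 * (length transcripts * b ^ t)  ≤⟨ *-monoˡ-≤ (length transcripts * b ^ t) (≤ᵇ⇒≤ 60 63 _) ⟩
      63 * (length transcripts * b ^ t)  ≡⟨ swap″ (length transcripts) (b ^ t) ⟩
      b ^ t * (9 * (7 * length transcripts)) ∎))
      where
      swap : ∀ p q r → p * (q * r) ≡ r * (q * p)
      swap = solve-∀
      swap′ : ∀ p q r → p * (q * r) ≡ q * (p * r)
      swap′ = solve-∀
      swap″ : ∀ l p → 63 * (l * p) ≡ p * (9 * (7 * l))
      swap″ = solve-∀

n≤2^⌈log₂n⌉ : ∀ n → n ≤ 2 ^ ⌈log₂ n ⌉
n≤2^⌈log₂n⌉ = <-rec (λ n → n ≤ 2 ^ ⌈log₂ n ⌉) step
  where
  step : ∀ n → (∀ {y} → y < n → y ≤ 2 ^ ⌈log₂ y ⌉) → n ≤ 2 ^ ⌈log₂ n ⌉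
  step zero          _  = z≤n
  step (suc zero)    _  = s≤s z≤n
  step n@(suc (suc k)) ih = begin
    n                         ≡⟨ sym (⌊n/2⌋+⌈n/2⌉≡n n) ⟩
    ⌊ n /2⌋ + ⌈ n /2⌉         ≤⟨ +-monoˡ-≤ ⌈ n /2⌉ (⌊n/2⌋≤⌈n/2⌉ n) ⟩
    ⌈ n /2⌉ + ⌈ n /2⌉         ≤⟨ +-mono-≤ half≤ half≤ ⟩
    2 ^ (L ∸ 1) + 2 ^ (L ∸ 1) ≡⟨ cong (2 ^ (L ∸ 1) +_) (sym (+-identityʳ _)) ⟩
    2 ^ suc (L ∸ 1)           ≡⟨ cong (2 ^_) (trans (+-comm 1 (L ∸ 1)) (m∸n+n≡m 1≤L)) ⟩
    2 ^ L                     ∎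
    where
    open ≤-Reasoning
    L = ⌈log₂ n ⌉
    1≤L : 1 ≤ L
    1≤L = subst (_≤ L) (⌈log₂2^n⌉≡n 1) (⌈log₂⌉-mono-≤ {2} {n} (s≤s (s≤s z≤n)))
    half≤ : ⌈ n /2⌉ ≤ 2 ^ (L ∸ 1)
    half≤ = subst (λ e → ⌈ n /2⌉ ≤ 2 ^ e) (⌈log₂⌈n/2⌉⌉≡⌈log₂n⌉∸1 n) (ih (⌈n/2⌉<n k))

exponent≤ : ∀ h v → 1 ≤ h → 1 ≤ v → (3 + suc v * (6 * (h + h + 6) + 6 * (h + h + 6))) * 6 ≤ 1170 * (h * v)
exponent≤ (suc h′) (suc v′) _ _ =
  ≤-trans (m≤m+n _ (882 * h′ + 594 * v′ + 1026 * (h′ * v′))) (≤-reflexive (expand h′ v′))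
  where
  expand : ∀ a c → (3 + suc (suc c) * (6 * (suc a + suc a + 6) + 6 * (suc a + suc a + 6))) * 6
                     + (882 * a + 594 * c + 1026 * (a * c)) ≡ 1170 * (suc a * suc c)
  expand = solve-∀

[7*2^e]^6≤ : ∀ e → (7 * 2 ^ e) ^ 6 ≤ 2 ^ ((3 + e) * 6)
[7*2^e]^6≤ e = begin
  (7 * 2 ^ e) ^ 6     ≤⟨ ^-monoˡ-≤ 6 (*-monoˡ-≤ (2 ^ e) (≤ᵇ⇒≤ 7 8 _)) ⟩
  (2 ^ 3 * 2 ^ e) ^ 6 ≡⟨ cong (_^ 6) (sym (^-distribˡ-+-* 2 3 e)) ⟩
  (2 ^ (3 + e)) ^ 6   ≡⟨ ^-*-assoc 2 (3 + e) 6 ⟩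
  2 ^ ((3 + e) * 6)   ∎
  where open ≤-Reasoning

7*[2^[1+v]]^k^6≤ : ∀ v k E → (3 + suc v * k) * 6 ≤ E → (7 * (2 ^ suc v) ^ k) ^ 6 ≤ 2 ^ E
7*[2^[1+v]]^k^6≤ v k E e≤E =
  ≤-trans (≤-reflexive (cong (λ z → (7 * z) ^ 6) (^-*-assoc 2 (suc v) k)))
          (≤-trans ([7*2^e]^6≤ (suc v * k)) (^-monoʳ-≤ 2 e≤E))

n^m≤-large-ratio : ∀ m n E .{{_ : NonZero m}} → 2 ≤ n / m → (n / m) ^ m ≤ 2 ^ E → n ^ m ≤ 2 ^ (3 * E) * m ^ m
n^m≤-large-ratio m n E 2≤b b^m≤ = begin
  n ^ m                       ≤⟨ ^-monoˡ-≤ m (<⇒≤ n<[1+b]*m) ⟩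
  (suc b * m) ^ m             ≡⟨ ^-distribʳ-* (suc b) m m ⟩
  suc b ^ m * m ^ m           ≤⟨ *-monoˡ-≤ (m ^ m) (^-monoˡ-≤ m 1+b≤b*b) ⟩
  (b * b) ^ m * m ^ m         ≡⟨ cong (_* m ^ m) (^-distribʳ-* b b m) ⟩
  b ^ m * b ^ m * m ^ m       ≤⟨ *-monoˡ-≤ (m ^ m) (*-mono-≤ b^m≤ b^m≤) ⟩
  2 ^ E * 2 ^ E * m ^ m       ≡⟨ cong (_* m ^ m) (sym (^-distribˡ-+-* 2 E E)) ⟩
  2 ^ (E + E) * m ^ m         ≤⟨ *-monoˡ-≤ (m ^ m) (^-monoʳ-≤ 2 (≤-trans (m≤m+n (E + E) E) (≤-reflexive (thrice E)))) ⟩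
  2 ^ (3 * E) * m ^ m         ∎
  where
  open ≤-Reasoning
  b = n / m
  n<[1+b]*m : n < suc b * m
  n<[1+b]*m = begin-strict
    n             ≡⟨ m≡m%n+[m/n]*n n m ⟩
    n % m + b * m <⟨ +-monoˡ-< (b * m) (m%n<n n m) ⟩
    m + b * m     ∎
  1+b≤b*b : suc b ≤ b * b
  1+b≤b*b = ≤-trans (+-monoˡ-≤ b (≤-trans (s≤s z≤n) 2≤b))
                    (≤-trans (≤-reflexive (cong (b +_) (sym (+-identityʳ b)))) (*-monoˡ-≤ b 2≤b))
  thrice : ∀ e → e + e + e ≡ 3 * e
  thrice = solve-∀

n^m≤-small-ratio : ∀ m n E .{{_ : NonZero m}} → m ≤ n → 1 ≤ E → n / m < 2 → (n / 2 ≤ m → n / 2 ≤ E) →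
                   n ^ m ≤ 2 ^ (3 * E) * m ^ m
n^m≤-small-ratio m n E m≤n 1≤E b<2 n/2≤E = begin
  n ^ m               ≤⟨ ^-monoˡ-≤ m n≤2m ⟩
  (2 * m) ^ m         ≡⟨ ^-distribʳ-* 2 m m ⟩
  2 ^ m * m ^ m       ≤⟨ *-monoˡ-≤ (m ^ m) (^-monoʳ-≤ 2 m≤3E) ⟩
  2 ^ (3 * E) * m ^ m ∎
  where
  open ≤-Reasoning
  n≤2m : n ≤ 2 * m
  n≤2m = begin
    n                 ≡⟨ m≡m%n+[m/n]*n n m ⟩
    n % m + n / m * m ≤⟨ +-mono-≤ (<⇒≤ (m%n<n n m)) (*-monoˡ-≤ m (s≤s⁻¹ b<2)) ⟩
    m + 1 * m         ≡⟨ cong (m +_) (*-identityˡ m) ⟩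
    m + m             ≡⟨ cong (m +_) (sym (+-identityʳ m)) ⟩
    2 * m             ∎
  n/2≤m : n / 2 ≤ m
  n/2≤m = ≤-trans (/-monoˡ-≤ 2 n≤2m) (≤-reflexive (trans (cong (_/ 2) (*-comm 2 m)) (m*n/n≡m m 2)))
  m≤3E : m ≤ 3 * E
  m≤3E = begin
    m                 ≤⟨ m≤n ⟩
    n                 ≡⟨ m≡m%n+[m/n]*n n 2 ⟩
    n % 2 + n / 2 * 2 ≤⟨ +-mono-≤ (s≤s⁻¹ (m%n<n n 2)) (*-monoˡ-≤ 2 (n/2≤E n/2≤m)) ⟩
    1 + E * 2         ≤⟨ +-monoˡ-≤ (E * 2) 1≤E ⟩
    E + E * 2         ≡⟨ thrice E ⟩
    3 * E             ∎
    where
    thrice : ∀ e → e + e * 2 ≡ 3 * e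
    thrice = solve-∀

^-cancelˡ-≤ : ∀ a e → 2 ^ a ≤ 2 ^ e → a ≤ e
^-cancelˡ-≤ a e 2^a≤2^e with a ≤? e
... | yes a≤e = a≤e
... | no  a≰e = ⊥-elim (<⇒≱ (^-monoʳ-< 2 (s≤s (s≤s z≤n)) (≰⇒> a≰e)) 2^a≤2^e)

n^m≤2^[3E]*m^m : ∀ m n E .{{_ : NonZero m}} → m ≤ n → 1 ≤ E →
                 (∀ t b → t * b ≤ n → t ≤ m → b ^ t ≤ 2 ^ E) → n ^ m ≤ 2 ^ (3 * E) * m ^ m
n^m≤2^[3E]*m^m m n E m≤n 1≤E b^t≤2^E with 2 ≤? n / m
... | yes 2≤n/m = n^m≤-large-ratio m n E 2≤n/m
                    (b^t≤2^E m (n / m) (≤-trans (≤-reflexive (*-comm m (n / m))) (m/n*n≤m n m)) ≤-refl)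
... | no  2≰n/m = n^m≤-small-ratio m n E m≤n 1≤E (≰⇒> 2≰n/m)
                    (λ n/2≤m → ^-cancelˡ-≤ (n / 2) E (b^t≤2^E (n / 2) 2 (m/n*n≤m n 2) n/2≤m))

length≤0⇒[] : (l : List A) → length l ≤ 0 → l ≡ []
length≤0⇒[] [] _ = refl

weight-replicate-false : ∀ n → weight (Vec.replicate n false) ≡ 0
weight-replicate-false zero    = refl
weight-replicate-false (suc n) = weight-replicate-false n

module SparseIndexBound
  {m n : ℕ} (1≤m : 1 ≤ m) (m≤n : m ≤ n) (P : Protocol (SparseInput m n) (Fin n))
  (complete : Complete⅓ (sparseIndex m n) P) (sound : Sound⅓ (sparseIndex m n) P)
  {h v : ℕ}
  (help≤ : ∀ x y rM → 1 + (length (h₁ P x rM) + length (h₂ P x y rM)) ≤ h)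
  (message≤ : ∀ x m₁ rA → length (alice P x m₁ rA) ≤ v)
  (n≤2^h : n ≤ 2 ^ h)
  where

  zeros : SparseInput m n
  zeros = Vec.replicate n false , subst (_≤ m) (sym (weight-replicate-false n)) z≤n

  1≤h : 1 ≤ h
  1≤h = ≤-trans (s≤s z≤n) (help≤ zeros (fromℕ< (≤-trans 1≤m m≤n)) (Vec.replicate (ℓM P) false))

  1≤v : 1 ≤ v
  1≤v = n≢0⇒n>0 λ v≡0 → silent-alice⇒⊥ (sparseIndex m n) P complete sound
    (input c) zeros (target c zero) (input-target c zero) (lookup-replicate (target c zero) false)
    (λ m₁ rA → trans (silent v≡0 (input c) m₁ rA) (sym (silent v≡0 zeros m₁ rA)))
    where
    open HardInputs {t = 1} {b = 1} (≤-trans 1≤m m≤n) 1≤m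
    c : Vec (Fin 1) 1
    c = zero ∷ []
    silent : v ≡ 0 → ∀ x m₁ rA → alice P x m₁ rA ≡ []
    silent refl x m₁ rA = length≤0⇒[] (alice P x m₁ rA) (message≤ x m₁ rA)

  E : ℕ
  E = 1170 * (h * v)

  b^t≤2^E : ∀ t b → t * b ≤ n → t ≤ m → b ^ t ≤ 2 ^ E
  b^t≤2^E zero      b         _    _   = m^n>0 2 E
  b^t≤2^E (suc t)   zero      _    _   = z≤n
  b^t≤2^E t@(suc _) b@(suc _) tb≤n t≤m =
    ≤-trans (BlockBound.blocks-bound P complete sound help≤ message≤ n≤2^h tb≤n t≤m)
            (7*[2^[1+v]]^k^6≤ v (BlockBound.k P complete sound help≤ message≤ n≤2^h tb≤n t≤m) E (exponent≤ h v 1≤h 1≤v))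

  n^m≤ : n ^ m ≤ 2 ^ (3510 * (h * v)) * m ^ m
  n^m≤ = ≤-trans (n^m≤2^[3E]*m^m m n E {{>-nonZero 1≤m}} m≤n (≤-trans (*-mono-≤ 1≤h 1≤v) (m≤n*m (h * v) 1170)) b^t≤2^E)
                 (≤-reflexive (cong (λ e → 2 ^ e * m ^ m) (sym (*-assoc 3 1170 (h * v)))))

theorem3p10 : ∃[ C ] (∀ (m n : ℕ) → 1 ≤ m → m ≤ n →
    (P : Protocol (SparseInput m n) (Fin n)) → ErrorAtMost⅓ (sparseIndex m n) P →
    (h v : ℕ) → IsHCost P h → IsVCost P v → ⌈log₂ n ⌉ ≤ h →
    n ^ m ≤ 2 ^ (C * (h * v)) * m ^ m)
theorem3p10 = 3510 , λ m n 1≤m m≤n P (complete , sound) h v (help≤ , _) (message≤ , _) ⌈log₂n⌉≤h →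
  SparseIndexBound.n^m≤ 1≤m m≤n P complete sound help≤ message≤ (≤-trans (n≤2^⌈log₂n⌉ n) (^-monoʳ-≤ 2 ⌈log₂n⌉≤h))
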